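{- Let $d,k,r\ge 1$ be integers, let $G$ be a $k\times k$ pseudogrid and let $\varphi$ be a vertex colouring of $G$ that uses $|\varphi(V(G))|\le k/(d+2r)$ colours. Then $G$ contains (as a subgraph) a $k'\times k'$ pseudogrid $G'$ with $k'\ge k-(d+2r)|\varphi(V(G))|$ that has a grid-partition $\mathcal{P}'=\{V(P'_\mu):\mu\in\mathrm{VE}(G_{k'})\}$ such that for every $A\subseteq\varphi(V(G'))$, \[ |\varphi_{\mathcal{P}'}^{ -1}(A)\cap \mathrm{VE}(\mathrm{int}_r(G_{k'}))|\ge d|A| . \]
   Context: For a graph $H$, $\mathrm{VE}(H):=V(H)\cup E(H)$; its elements are called objects. For positive integers $a,b$, the $a\times b$ grid $G_{a\times b}$ has vertex set $\{1,\dots,a\}\times\{1,\dots,b\}$, with $(i_1,j_1),(i_2,j_2)$ adjacent iff $|i_1-i_2|+|j_1-j_2|=1$; write $G_k:=G_{k\times k}$. An $a\times b$ pseudogrid is any graph obtained from $G_{a\times b}$ as follows. First, each edge $vw$ is replaced by a path $\overline{P}_{vw}$ with endpoints $v,w$ (subdividing $vw$ zero or more times); $P_{vw}$ denotes the (possibly empty) path of internal vertices of $\overline{P}_{vw}$. Then each vertex $v=(i,j)$ of degree $4$ is replaced by a nonempty path $P_v$: if $P_v$ has one vertex it takes the place of $v$; otherwise $P_v$ has endpoints $p,q$ and each of the four edges formerly joining $v$ to its neighbour on $\overline{P}_{vu}$ is redirected to $p$ or $q$ according to one of: (Q1) edges toward $(i-1,j),(i,j-1)$ to $p$, toward $(i+1,j),(i,j+1)$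 to $q$; (Q2) edges toward $(i,j+1),(i-1,j)$ to $p$, toward $(i,j-1),(i+1,j)$ to $q$; (Q3) edges toward $(i-1,j),(i+1,j)$ to $p$, toward $(i,j-1),(i,j+1)$ to $q$. For a vertex $v$ of degree less than $4$, $P_v$ is the one-vertex path on $v$. The resulting partition $\mathcal{P}=\{V(P_\mu):\mu\in\mathrm{VE}(G_{a\times b})\}$ of $V(G)$ (empty parts allowed for edges) is called a grid-partition of $G$. For $0\le r<\min\{a,b\}/2$, $\mathrm{int}_r(G_{a\times b})$ is the induced subgraph of $G_{a\times b}$ on $\{1+r,\dots,a-r\}\times\{1+r,\dots,b-r\}$; for $r\ge\min\{a,b\}/2$ it is the empty graph. For a vertex colouring $\varphi$ of a pseudogrid with grid-partition $\mathcal{P}$ and $\mu\in\mathrm{VE}(G_{a\times b})$, $\varphi_{\mathcal{P}}(\mu):=\{\varphi(v):v\in V(P_\mu)\}$, and for a set of colours $A$, $\varphi_{\mathcal{P}}^{ -1}(A):=\{\mu:\varphi_{\mathcal{P}}(\mu)\cap A\neq\emptyset\}$. $\varphi(V(G))$ denotes the set of colours used on $V(G)$. -}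

module Defs where

open import Data.Nat using (ℕ; zero; suc; _+_; _*_; _∸_; _≤_; _<_)
open import Data.Product using (Σ; ∃; _×_; _,_)
open import Data.Sum using (_⊎_)
open import Data.List using (List; length)
open import Data.List.Membership.Propositional using (_∈_)
open import Relation.Binary.PropositionalEquality using (_≡_)
open import Relation.Nullary using (¬_)

-- Coordinates are 0-indexed: the paper's vertex (i,j) (1-indexed) is vx (i-1) (j-1).
-- Objects of a grid: vertices and edges.
data Obj : Set where
  vx : ℕ → ℕ → Obj
  eh : ℕ → ℕ → Obj   -- edge (i,j)(i,j+1)
  ev : ℕ → ℕ → Obj   -- edge (i,j)(i+1,j)

IsObj : ℕ → ℕ → Obj → Set
IsObj a b (vx i j) = i < a × j < b
IsObj a b (eh i j) = i < a × suc j < b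
IsObj a b (ev i j) = suc i < a × j < b

-- 0-indexed coordinate i lies in {r,…,n-r-1} (the paper's {1+r,…,n-r})
InRange : ℕ → ℕ → ℕ → Set
InRange n r i = r ≤ i × i + r < n

-- μ ∈ VE(int_r(G_{a×b})) (induced subgraph on the inner coordinates;
-- automatically empty when r ≥ min{a,b}/2)
InInt : ℕ → ℕ → ℕ → Obj → Set
InInt a b r (vx i j) = InRange a r i × InRange b r j
InInt a b r (eh i j) = InRange a r i × InRange b r j × InRange b r (suc j)
InInt a b r (ev i j) = InRange a r i × InRange a r (suc i) × InRange b r j

Deg4 : ℕ → ℕ → ℕ → ℕ → Set
Deg4 a b i j = 0 < i × suc i < a × 0 < j × suc j < b

data QType : Set where
  Q1 Q2 Q3 : QType

-- directions: up = toward (i-1,j), left = toward (i,j-1),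
-- down = toward (i+1,j), right = toward (i,j+1)
data Dir : Set where
  up left down right : Dir

data End : Set where
  pEnd qEnd : End

side : QType → Dir → End
side Q1 up    = pEnd
side Q1 left  = pEnd
side Q1 down  = qEnd
side Q1 right = qEnd
side Q2 right = pEnd
side Q2 up    = pEnd
side Q2 left  = qEnd
side Q2 down  = qEnd
side Q3 up    = pEnd
side Q3 down  = pEnd
side Q3 left  = qEnd
side Q3 right = qEnd

-- Construction data of an a×b pseudogrid: len μ = |V(P_μ)| for each object μ,
-- and the rule (Q1/Q2/Q3) used at each degree-4 vertex.
record PGData (a b : ℕ) : Set where
  field
    len     : Obj → ℕ
    qtype   : ℕ → ℕ → QType
    len-vx  : ∀ i j → i < a → j < b → 1 ≤ len (vx i j)
    len-deg : ∀ i j → i < a → j < b → ¬ Deg4 a b i j → len (vx i j) ≡ 1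

open PGData public

-- Vertices of the pseudogrid built from D: pairs (μ , t) meaning the t-th vertex
-- (0-indexed, along the path) of P_μ.
PVtx : Set
PVtx = Obj × ℕ

IsVtx : ∀ {a b} → PGData a b → PVtx → Set
IsVtx {a} {b} D (μ , t) = IsObj a b μ × t < len D μ

-- position in P_(i,j) to which the edge in direction dir is attached
-- (p = first vertex, q = last vertex of P_(i,j))
attach : ∀ {a b} → PGData a b → ℕ → ℕ → Dir → ℕ
attach D i j dir with side (qtype D i j) dir
... | pEnd = 0
... | qEnd = len D (vx i j) ∸ 1

data Link {a b : ℕ} (D : PGData a b) : PVtx → PVtx → Set where
  inner   : ∀ μ t → IsObj a b μ → suc t < len D μ → Link D (μ , t) (μ , suc t)
  h-direct : ∀ i j → IsObj a b (eh i j) → len D (eh i j) ≡ 0 →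
             Link D (vx i j , attach D i j right) (vx i (suc j) , attach D i (suc j) left)
  h-start : ∀ i j → IsObj a b (eh i j) → 1 ≤ len D (eh i j) →
             Link D (vx i j , attach D i j right) (eh i j , 0)
  h-end   : ∀ i j → IsObj a b (eh i j) → 1 ≤ len D (eh i j) →
             Link D (eh i j , len D (eh i j) ∸ 1) (vx i (suc j) , attach D i (suc j) left)
  v-direct : ∀ i j → IsObj a b (ev i j) → len D (ev i j) ≡ 0 →
             Link D (vx i j , attach D i j down) (vx (suc i) j , attach D (suc i) j up)
  v-start : ∀ i j → IsObj a b (ev i j) → 1 ≤ len D (ev i j) →
             Link D (vx i j , attach D i j down) (ev i j , 0)
  v-end   : ∀ i j → IsObj a b (ev i j) → 1 ≤ len D (ev i j) →
             Link D (ev i j , len D (ev i j) ∸ 1) (vx (suc i) j , attach D (suc i) j up)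

Adj : ∀ {a b} → PGData a b → PVtx → PVtx → Set
Adj D x y = Link D x y ⊎ Link D y x

Used : ∀ {a b} → PGData a b → (PVtx → ℕ) → ℕ → Set
Used D φ c = ∃ λ x → IsVtx D x × φ x ≡ c

-- φ_P(μ) ∩ A ≠ ∅ for the canonical grid-partition P of the pseudogrid built from D
Hits : ∀ {a b} → PGData a b → (PVtx → ℕ) → List ℕ → Obj → Set
Hits D φ A μ = ∃ λ t → t < len D μ × φ (μ , t) ∈ A

{-# OPTIONS --safe #-}
-- If a set S of colours still present meets fewer than d|S| objects of the r-interior, delete the row
-- and the column through each of these objects and then peel off r outer layers.  What remains is a
-- pseudogrid inside the old one in which no colour of S occurs, and it is smaller by less than
-- d|S| + 2r ≤ (d + 2r)|S|.  Repeating this while such an S exists discards every colour at most once,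
-- so the size drops by at most (d + 2r)|φ(V(G))| in total, and at the end every S is good.
-- Deleting a row merges its vertex paths into the vertical edges through it, and peeling the top row
-- turns the paths of the second row into the new top row and its outgoing edges; transposition and
-- reflection transport these operations to the other sides.

module Submission where

open import Defs
open import Data.Nat
open import Data.Nat.Properties
open import Data.Bool using (Bool; true; false)
open import Data.Product using (Σ; ∃; _×_; _,_; proj₁; proj₂; map₁; map₂)
import Data.Sum
open import Data.Sum using (_⊎_; inj₁; inj₂)
open import Data.Empty using (⊥-elim)
open import Data.List using (List; []; _∷_; length; map; _++_; filter; deduplicate)
open import Data.List.Properties using (length-map; length-++)
open import Data.List.Membership.Propositional using (_∈_; _∉_; find)
open import Data.List.Membership.Propositional.Properties
  using (∉[]; ∈-map⁺; ∈-map⁻; ∈-++⁺ˡ; ∈-++⁺ʳ; ∈-++⁻; ∈-∃++; ∈-filter⁺; ∈-filter⁻; ∈-deduplicate⁺; ∈-deduplicate⁻)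
open import Data.List.Membership.DecPropositional _≟_ using (_∈?_)
open import Data.List.Relation.Unary.Any using (here; there)
open import Data.List.Relation.Unary.All using (All; tabulate; all?) renaming (lookup to All-lookup)
open import Data.List.Relation.Unary.All.Properties using (¬All⇒Any¬)
open import Data.List.Relation.Unary.Unique.Propositional using (Unique)
import Data.List.Relation.Unary.AllPairs as AllPairs
import Data.List.Relation.Unary.Unique.DecPropositional.Properties as UniqueDec
open import Relation.Nullary using (¬_; Dec; yes; no)
open import Relation.Nullary.Decidable using (_×-dec_; ¬?; map′)
open import Relation.Binary using (Tri; tri<; tri≈; tri>)
open import Relation.Binary.PropositionalEquality
open import Relation.Binary.Definitions using (DecidableEquality)
open import Function using (_∘_; _⇔_; Equivalence)

endIndex : End → ℕ → ℕ
endIndex pEnd L = 0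
endIndex qEnd L = L ∸ 1

attach-endIndex : ∀ {a b} (D : PGData a b) i j dir →
  attach D i j dir ≡ endIndex (side (qtype D i j) dir) (len D (vx i j))
attach-endIndex D i j dir with side (qtype D i j) dir
... | pEnd = refl
... | qEnd = refl

attach-up : ∀ {a b} (D : PGData a b) i j → attach D i j up ≡ 0
attach-up D i j = trans (attach-endIndex D i j up) (up-at-p (qtype D i j))
  where
  up-at-p : ∀ q → endIndex (side q up) (len D (vx i j)) ≡ 0
  up-at-p Q1 = refl
  up-at-p Q2 = refl
  up-at-p Q3 = refl

endIndex-≤ : ∀ e L → endIndex e L ≤ L ∸ 1
endIndex-≤ pEnd L = z≤n
endIndex-≤ qEnd L = ≤-refl

n∸1<n : ∀ {n} → 1 ≤ n → n ∸ 1 < n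
n∸1<n {suc n} _ = ≤-refl

attach-< : ∀ {a b} (D : PGData a b) i j dir → i < a → j < b → attach D i j dir < len D (vx i j)
attach-< D i j dir i<a j<b rewrite attach-endIndex D i j dir =
  ≤-<-trans (endIndex-≤ (side (qtype D i j) dir) _) (n∸1<n (len-vx D i j i<a j<b))

Adj-sym : ∀ {a b} {D : PGData a b} {x y} → Adj D x y → Adj D y x
Adj-sym (inj₁ l) = inj₂ l
Adj-sym (inj₂ l) = inj₁ l

Walk : ∀ {a b} → PGData a b → (ℕ → PVtx) → ℕ → Set
Walk D s n = ∀ k → k < n → Adj D (s k) (s (suc k))

Walk-cong : ∀ {a b} {D : PGData a b} {s s′ : ℕ → PVtx} n →
  (∀ k → k ≤ n → s k ≡ s′ k) → Walk D s n → Walk D s′ n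
Walk-cong {D = D} n eq w k k<n = subst₂ (Adj D) (eq k (<⇒≤ k<n)) (eq (suc k) k<n) (w k k<n)

∸-suc : ∀ {n k} → k < n → n ∸ k ≡ suc (n ∸ suc k)
∸-suc {suc n} {zero} _ = refl
∸-suc {suc n} {suc k} (s≤s k<n) = ∸-suc k<n

∸-suc-< : ∀ {n} k → k < n → n ∸ suc k < n
∸-suc-< {suc n} k _ = s≤s (m∸n≤m n k)

Walk-reverse : ∀ {a b} {D : PGData a b} (s : ℕ → PVtx) n → Walk D s n → Walk D (λ k → s (n ∸ k)) n
Walk-reverse {D = D} s n w k k<n rewrite ∸-suc k<n = Adj-sym (w (n ∸ suc k) (∸-suc-< k k<n))

route : PVtx → (ℕ → PVtx) → ℕ → PVtx → ℕ → PVtx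
route u f n w zero = u
route u f n w (suc k) with k <? n
... | yes _ = f k
... | no _ = w

route-inner : ∀ u f n w k → k < n → route u f n w (suc k) ≡ f k
route-inner u f n w k k<n with k <? n
... | yes _ = refl
... | no k≮n = ⊥-elim (k≮n k<n)

route-last : ∀ u f n w → route u f n w (suc n) ≡ w
route-last u f n w with n <? n
... | yes n<n = ⊥-elim (<-irrefl refl n<n)
... | no _ = refl

route-cong : ∀ {u u′ f g n w w′} → u ≡ u′ → (∀ t → f t ≡ g t) → w ≡ w′ →
  ∀ k → route u f n w k ≡ route u′ g n w′ k
route-cong eu ef ew zero = eu
route-cong {n = n} eu ef ew (suc k) with k <? n
... | yes _ = ef k
... | no _ = ew

route-unique : ∀ (s : ℕ → PVtx) u n w → s 0 ≡ u → s (suc n) ≡ w →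
  ∀ k → k ≤ suc n → s k ≡ route u (s ∘ suc) n w k
route-unique s u n w s0 sn zero _ = s0
route-unique s u n w s0 sn (suc k) (s≤s k≤n) with k <? n
... | yes _ = refl
... | no k≮n with ≤-antisym k≤n (≮⇒≥ k≮n)
...   | refl = sn

Walk-route-cong : ∀ {a b} {D : PGData a b} {u f n w u′ g w′} →
  u ≡ u′ → (∀ t → f t ≡ g t) → w ≡ w′ →
  Walk D (route u f n w) (suc n) → Walk D (route u′ g n w′) (suc n)
Walk-route-cong eu ef ew = Walk-cong _ (λ k _ → route-cong eu ef ew k)

Walk-route : ∀ {a b} {D : PGData a b} u f n w →
  (n ≡ 0 → Adj D u w) → (0 < n → Adj D u (f 0)) →
  (∀ t → suc t < n → Adj D (f t) (f (suc t))) → (0 < n → Adj D (f (n ∸ 1)) w) →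
  Walk D (route u f n w) (suc n)
Walk-route {D = D} u f zero w direct _ _ _ zero _ rewrite route-last u f 0 w = direct refl
Walk-route {D = D} u f (suc n) w _ start _ _ zero _ = start (s≤s z≤n)
Walk-route {D = D} u f n w _ _ step end (suc k) (s≤s k<n) = next (suc k <? n)
  where
  next : Dec (suc k < n) → Adj D (route u f n w (suc k)) (route u f n w (suc (suc k)))
  next (yes sk<n) = subst₂ (Adj D) (sym (route-inner u f n w k k<n)) (sym (route-inner u f n w (suc k) sk<n))
                      (step k sk<n)
  next (no sk≮n) with ≤-antisym k<n (≮⇒≥ sk≮n)
  ... | refl = subst₂ (Adj D) (sym (route-inner u f n w k k<n)) (sym (route-last u f n w)) (end (s≤s z≤n))

module _ {a b} {D : PGData a b} (u : PVtx) (f : ℕ → PVtx) (n : ℕ) (w : PVtx)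
         (W : Walk D (route u f n w) (suc n)) where

  Walk-route-direct : n ≡ 0 → Adj D u w
  Walk-route-direct refl = subst (Adj D u) (route-last u f 0 w) (W 0 (s≤s z≤n))

  Walk-route-start : 0 < n → Adj D u (f 0)
  Walk-route-start 0<n = subst (Adj D u) (route-inner u f n w 0 0<n) (W 0 (s≤s z≤n))

  Walk-route-inner : ∀ t → suc t < n → Adj D (f t) (f (suc t))
  Walk-route-inner t st<n =
    subst₂ (Adj D) (route-inner u f n w t (<-trans (n<1+n t) st<n)) (route-inner u f n w (suc t) st<n)
      (W (suc t) (s≤s (<⇒≤ st<n)))

  Walk-route-end : 0 < n → Adj D (f (n ∸ 1)) w
  Walk-route-end 0<n = subst₂ (Adj D) (route-penultimate 0<n) (route-last u f n w) (W n (n<1+n n))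
    where
    route-penultimate : ∀ {n} → 0 < n → route u f n w n ≡ f (n ∸ 1)
    route-penultimate {suc m} _ = route-inner u f (suc m) w m (n<1+n m)

route-reverse : ∀ u f n w (g : ℕ → PVtx) → (∀ t → t < n → g t ≡ f (n ∸ 1 ∸ t)) →
  ∀ k → k ≤ suc n → route w g n u k ≡ route u f n w (suc n ∸ k)
route-reverse u f n w g g≡ zero _ = sym (route-last u f n w)
route-reverse u f n w g g≡ (suc k) (s≤s k≤n) with k <? n
... | yes k<n rewrite ∸-suc k<n | route-inner u f n w (n ∸ suc k) (∸-suc-< k k<n) =
  trans (g≡ k k<n) (cong f (∸-+-assoc n 1 k))
... | no k≮n with ≤-antisym k≤n (≮⇒≥ k≮n)
...   | refl rewrite n∸n≡0 k = refl

Walk-route-reverse : ∀ {a b} {D : PGData a b} u f n w (g : ℕ → PVtx) →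
  (∀ t → t < n → g t ≡ f (n ∸ 1 ∸ t)) →
  Walk D (route u f n w) (suc n) → Walk D (route w g n u) (suc n)
Walk-route-reverse u f n w g g≡ W =
  Walk-cong (suc n) (λ k k≤ → sym (route-reverse u f n w g g≡ k k≤)) (Walk-reverse (route u f n w) (suc n) W)

glue : ℕ → (ℕ → PVtx) → (ℕ → PVtx) → ℕ → PVtx
glue n s s′ k with k <? n
... | yes _ = s k
... | no _ = s′ (k ∸ n)

glue-< : ∀ n s s′ k → k < n → glue n s s′ k ≡ s k
glue-< n s s′ k k<n with k <? n
... | yes _ = refl
... | no k≮n = ⊥-elim (k≮n k<n)

glue-≥ : ∀ n s s′ k → n ≤ k → glue n s s′ k ≡ s′ (k ∸ n)
glue-≥ n s s′ k n≤k with k <? n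
... | yes k<n = ⊥-elim (<-irrefl refl (≤-trans k<n n≤k))
... | no _ = refl

glue-+ : ∀ n s s′ m → glue n s s′ (n + m) ≡ s′ m
glue-+ n s s′ m = trans (glue-≥ n s s′ (n + m) (m≤m+n n m)) (cong s′ (m+n∸m≡n n m))

glue-≤ : ∀ n s s′ k → s n ≡ s′ 0 → k ≤ n → glue n s s′ k ≡ s k
glue-≤ n s s′ k sn≡ k≤n with k <? n
... | yes _ = refl
... | no k≮n with ≤-antisym k≤n (≮⇒≥ k≮n)
...   | refl rewrite n∸n≡0 k = sym sn≡

Walk-glue : ∀ {a b} {D : PGData a b} n m s s′ → Walk D s n → Walk D s′ m → s n ≡ s′ 0 →
  Walk D (glue n s s′) (n + m)
Walk-glue {D = D} n m s s′ w w′ sn≡ k k<n+m = step (k <? n)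
  where
  step : Dec (k < n) → Adj D (glue n s s′ k) (glue n s s′ (suc k))
  step (yes k<n) = subst₂ (Adj D) (sym (glue-< n s s′ k k<n)) (sym (glue-≤ n s s′ (suc k) sn≡ k<n)) (w k k<n)
  step (no k≮n) = subst₂ (Adj D) (sym (glue-≥ n s s′ k n≤k))
                    (sym (trans (glue-≥ n s s′ (suc k) (m≤n⇒m≤1+n n≤k)) (cong s′ (+-∸-assoc 1 n≤k))))
                    (w′ (k ∸ n) (subst (k ∸ n <_) (m+n∸m≡n n m) (∸-monoˡ-< k<n+m n≤k)))
    where
    n≤k : n ≤ k
    n≤k = ≮⇒≥ k≮n

hRoute vRoute : ∀ {a b} → PGData a b → (PVtx → PVtx) → ℕ → ℕ → ℕ → PVtx
hRoute D ι i j = route (ι (vx i j , attach D i j right)) (λ t → ι (eh i j , t)) (len D (eh i j))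
                       (ι (vx i (suc j) , attach D i (suc j) left))
vRoute D ι i j = route (ι (vx i j , attach D i j down)) (λ t → ι (ev i j , t)) (len D (ev i j))
                       (ι (vx (suc i) j , attach D (suc i) j up))

Walk-hRoute : ∀ {a b} (D : PGData a b) i j → IsObj a b (eh i j) → Walk D (hRoute D (λ x → x) i j) (suc (len D (eh i j)))
Walk-hRoute D i j o = Walk-route _ _ _ _ (λ e → inj₁ (h-direct i j o e)) (λ p → inj₁ (h-start i j o p))
                        (λ t p → inj₁ (inner (eh i j) t o p)) (λ p → inj₁ (h-end i j o p))

Walk-vRoute : ∀ {a b} (D : PGData a b) i j → IsObj a b (ev i j) → Walk D (vRoute D (λ x → x) i j) (suc (len D (ev i j)))
Walk-vRoute D i j o = Walk-route _ _ _ _ (λ e → inj₁ (v-direct i j o e)) (λ p → inj₁ (v-start i j o p))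
                        (λ t p → inj₁ (inner (ev i j) t o p)) (λ p → inj₁ (v-end i j o p))

record Contains {a b a′ b′} (D : PGData a b) (D′ : PGData a′ b′) : Set where
  field
    ι           : PVtx → PVtx
    ι-IsVtx     : ∀ x → IsVtx D′ x → IsVtx D (ι x)
    ι-injective : ∀ x y → IsVtx D′ x → IsVtx D′ y → ι x ≡ ι y → x ≡ y
    ι-Adj       : ∀ x y → IsVtx D′ x → IsVtx D′ y → Adj D′ x y → Adj D (ι x) (ι y)

open Contains public

mkContains : ∀ {a b a′ b′} (D : PGData a b) (D′ : PGData a′ b′) (ι : PVtx → PVtx) →
  (∀ x → IsVtx D′ x → IsVtx D (ι x)) →
  (π : PVtx → PVtx) → (∀ x → IsVtx D′ x → π (ι x) ≡ x) →
  (∀ i j t → IsObj a′ b′ (vx i j) → suc t < len D′ (vx i j) → Adj D (ι (vx i j , t)) (ι (vx i j , suc t))) →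
  (∀ i j → IsObj a′ b′ (eh i j) → Walk D (hRoute D′ ι i j) (suc (len D′ (eh i j)))) →
  (∀ i j → IsObj a′ b′ (ev i j) → Walk D (vRoute D′ ι i j) (suc (len D′ (ev i j)))) →
  Contains D D′
mkContains D D′ ι ι-IsVtx π πι vPath hWalk vWalk = record
  { ι = ι ; ι-IsVtx = ι-IsVtx ; ι-injective = injective ; ι-Adj = adjacent }
  where
  injective : ∀ x y → IsVtx D′ x → IsVtx D′ y → ι x ≡ ι y → x ≡ y
  injective x y vx′ vy eq = trans (sym (πι x vx′)) (trans (cong π eq) (πι y vy))
  link : ∀ {x y} → Link D′ x y → Adj D (ι x) (ι y)
  link (inner (vx i j) t o p) = vPath i j t o p
  link (inner (eh i j) t o p) = Walk-route-inner _ _ _ _ (hWalk i j o) t p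
  link (inner (ev i j) t o p) = Walk-route-inner _ _ _ _ (vWalk i j o) t p
  link (h-direct i j o e)     = Walk-route-direct _ _ _ _ (hWalk i j o) e
  link (h-start i j o p)      = Walk-route-start _ _ _ _ (hWalk i j o) p
  link (h-end i j o p)        = Walk-route-end _ _ _ _ (hWalk i j o) p
  link (v-direct i j o e)     = Walk-route-direct _ _ _ _ (vWalk i j o) e
  link (v-start i j o p)      = Walk-route-start _ _ _ _ (vWalk i j o) p
  link (v-end i j o p)        = Walk-route-end _ _ _ _ (vWalk i j o) p
  adjacent : ∀ x y → IsVtx D′ x → IsVtx D′ y → Adj D′ x y → Adj D (ι x) (ι y)
  adjacent x y _ _ (inj₁ l) = link l
  adjacent x y _ _ (inj₂ l) = Adj-sym (link l)

Contains-refl : ∀ {a b} (D : PGData a b) → Contains D D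
Contains-refl D = record { ι = λ x → x ; ι-IsVtx = λ x v → v ; ι-injective = λ x y _ _ e → e ; ι-Adj = λ x y _ _ a → a }

Contains-trans : ∀ {a b a₁ b₁ a₂ b₂} {D : PGData a b} {D₁ : PGData a₁ b₁} {D₂ : PGData a₂ b₂} →
  Contains D D₁ → Contains D₁ D₂ → Contains D D₂
Contains-trans E F = record
  { ι = ι E ∘ ι F
  ; ι-IsVtx = λ x v → ι-IsVtx E (ι F x) (ι-IsVtx F x v)
  ; ι-injective = λ x y vx′ vy eq →
      ι-injective F x y vx′ vy (ι-injective E (ι F x) (ι F y) (ι-IsVtx F x vx′) (ι-IsVtx F y vy) eq)
  ; ι-Adj = λ x y vx′ vy a → ι-Adj E (ι F x) (ι F y) (ι-IsVtx F x vx′) (ι-IsVtx F y vy) (ι-Adj F x y vx′ vy a) }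

rowMin rowMax colMin colMax : Obj → ℕ
rowMin (vx i j) = i
rowMin (eh i j) = i
rowMin (ev i j) = i
rowMax (vx i j) = i
rowMax (eh i j) = i
rowMax (ev i j) = suc i
colMin (vx i j) = j
colMin (eh i j) = j
colMin (ev i j) = j
colMax (vx i j) = j
colMax (eh i j) = suc j
colMax (ev i j) = j

Inset : ℕ → ℕ → ℕ → ℕ → ℕ → ℕ → Obj → Set
Inset a b t bo l ri μ = t ≤ rowMin μ × rowMax μ + bo < a × l ≤ colMin μ × colMax μ + ri < b

Inset-shift : ∀ δ {a b t bo l ri} μ′ μ → Inset a b t bo l ri μ′ →
  δ + rowMin μ′ ≤ rowMin μ → rowMax μ ≤ suc (rowMax μ′) → colMin μ′ ≤ colMin μ → colMax μ ≤ colMax μ′ →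
  Inset (suc a) b (δ + t) bo l ri μ
Inset-shift δ μ′ μ (p , q , r , s) e₁ e₂ e₃ e₄ =
  ≤-trans (+-monoʳ-≤ δ p) e₁ , ≤-<-trans (+-monoˡ-≤ _ e₂) (s≤s q) , ≤-trans r e₃ , ≤-<-trans (+-monoˡ-≤ _ e₄) s

flipIf : Bool → ℕ → ℕ → ℕ
flipIf false L t = t
flipIf true L t = L ∸ 1 ∸ t

flipIf-involutive : ∀ b L t → t < L → flipIf b L (flipIf b L t) ≡ t
flipIf-involutive false L t _ = refl
flipIf-involutive true (suc L) t (s≤s t≤L) = m∸[m∸n]≡n t≤L

flipIf-< : ∀ b L t → t < L → flipIf b L t < L
flipIf-< false L t t<L = t<L
flipIf-< true (suc L) t _ = s≤s (m∸n≤m L t)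

flipIf-Adj : ∀ {a b} (D : PGData a b) rev μ t → IsObj a b μ → suc t < len D μ →
  Adj D (μ , flipIf rev (len D μ) t) (μ , flipIf rev (len D μ) (suc t))
flipIf-Adj D false μ t o st<L = inj₁ (inner μ t o st<L)
flipIf-Adj D true μ t o st<L = inj₂ (subst (λ z → Link D (μ , L ∸ 1 ∸ suc t) (μ , z)) (L-1-suc L st<L)
  (inner μ (L ∸ 1 ∸ suc t) o (subst (_< L) (sym (L-1-suc L st<L)) (flipIf-< true L t (<-trans (n<1+n t) st<L)))))
  where
  L = len D μ
  L-1-suc : ∀ L → suc t < L → suc (L ∸ 1 ∸ suc t) ≡ L ∸ 1 ∸ t
  L-1-suc (suc L) (s≤s t<L) = sym (+-∸-assoc 1 t<L)

-- Transposition

transposeObj : Obj → Obj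
transposeObj (vx i j) = vx j i
transposeObj (eh i j) = ev j i
transposeObj (ev i j) = eh j i

transposeObj-involutive : ∀ μ → transposeObj (transposeObj μ) ≡ μ
transposeObj-involutive (vx i j) = refl
transposeObj-involutive (eh i j) = refl
transposeObj-involutive (ev i j) = refl

transposeDir : Dir → Dir
transposeDir up = left
transposeDir left = up
transposeDir down = right
transposeDir right = down

-- Transposing swaps p and q exactly for the rules Q2 and Q3, so those paths are read backwards.
transposeReverses : QType → Bool
transposeReverses Q1 = false
transposeReverses Q2 = true
transposeReverses Q3 = true

flipIf-transpose : ∀ q L dir →
  flipIf (transposeReverses q) L (endIndex (side q dir) L) ≡ endIndex (side q (transposeDir dir)) L
flipIf-transpose Q1 L up = refl
flipIf-transpose Q1 L left = refl
flipIf-transpose Q1 L down = refl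
flipIf-transpose Q1 L right = refl
flipIf-transpose Q2 L up = refl
flipIf-transpose Q2 L left = n∸n≡0 (L ∸ 1)
flipIf-transpose Q2 L down = n∸n≡0 (L ∸ 1)
flipIf-transpose Q2 L right = refl
flipIf-transpose Q3 L up = refl
flipIf-transpose Q3 L left = n∸n≡0 (L ∸ 1)
flipIf-transpose Q3 L down = refl
flipIf-transpose Q3 L right = n∸n≡0 (L ∸ 1)

transpose : ∀ {a b} → PGData a b → PGData b a
transpose D = record
  { len = λ μ → len D (transposeObj μ)
  ; qtype = λ i j → qtype D j i
  ; len-vx = λ i j i<b j<a → len-vx D j i j<a i<b
  ; len-deg = λ i j i<b j<a nd → len-deg D j i j<a i<b (λ { (p , q , r , s) → nd (r , s , p , q) }) }

module Transpose {a b} (D : PGData a b) where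
  D′ : PGData b a
  D′ = transpose D

  embed : PVtx → PVtx
  embed (vx i j , t) = (vx j i , flipIf (transposeReverses (qtype D j i)) (len D (vx j i)) t)
  embed (eh i j , t) = (ev j i , t)
  embed (ev i j , t) = (eh j i , t)

  proj : PVtx → PVtx
  proj (vx i j , t) = (vx j i , flipIf (transposeReverses (qtype D i j)) (len D (vx i j)) t)
  proj (eh i j , t) = (ev j i , t)
  proj (ev i j , t) = (eh j i , t)

  embed-attach : ∀ i j dir → embed (vx i j , attach D′ i j dir) ≡ (vx j i , attach D j i (transposeDir dir))
  embed-attach i j dir = cong (vx j i ,_) (begin
    flipIf rev L (attach D′ i j dir)                  ≡⟨ cong (flipIf rev L) (attach-endIndex D′ i j dir) ⟩
    flipIf rev L (endIndex (side q dir) L)            ≡⟨ flipIf-transpose q L dir ⟩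
    endIndex (side q (transposeDir dir)) L            ≡⟨ sym (attach-endIndex D j i (transposeDir dir)) ⟩
    attach D j i (transposeDir dir)                   ∎)
    where
    open ≡-Reasoning
    q = qtype D j i
    rev = transposeReverses q
    L = len D (vx j i)

  embed-IsVtx : ∀ x → IsVtx D′ x → IsVtx D (embed x)
  embed-IsVtx (vx i j , t) ((i<b , j<a) , t<) = (j<a , i<b) , flipIf-< (transposeReverses (qtype D j i)) _ t t<
  embed-IsVtx (eh i j , t) ((i<b , j<a) , t<) = (j<a , i<b) , t<
  embed-IsVtx (ev i j , t) ((i<b , j<a) , t<) = (j<a , i<b) , t<

  proj-embed : ∀ x → IsVtx D′ x → proj (embed x) ≡ x
  proj-embed (vx i j , t) (_ , t<) = cong (vx i j ,_) (flipIf-involutive (transposeReverses (qtype D j i)) _ t t<)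
  proj-embed (eh i j , t) _ = refl
  proj-embed (ev i j , t) _ = refl

  contains : Contains D D′
  contains = mkContains D D′ embed embed-IsVtx proj proj-embed
    (λ i j t (i<b , j<a) → flipIf-Adj D (transposeReverses (qtype D j i)) (vx j i) t (j<a , i<b))
    (λ i j (i<b , sj<a) → Walk-route-cong (sym (embed-attach i j right)) (λ _ → refl) (sym (embed-attach i (suc j) left))
                            (Walk-vRoute D j i (sj<a , i<b)))
    (λ i j (si<b , j<a) → Walk-route-cong (sym (embed-attach i j down)) (λ _ → refl) (sym (embed-attach (suc i) j up))
                            (Walk-hRoute D j i (j<a , si<b)))

  embed-obj : ∀ x → proj₁ (embed x) ≡ transposeObj (proj₁ x)
  embed-obj (vx i j , t) = refl
  embed-obj (eh i j , t) = refl
  embed-obj (ev i j , t) = refl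

  embed-Inset : ∀ x {t bo l ri} → Inset b a t bo l ri (proj₁ x) → Inset a b l ri t bo (proj₁ (embed x))
  embed-Inset (vx i j , _) (p , q , r , s) = r , s , p , q
  embed-Inset (eh i j , _) (p , q , r , s) = r , s , p , q
  embed-Inset (ev i j , _) (p , q , r , s) = r , s , p , q

-- Reflection in a horizontal axis

flipQType : QType → QType
flipQType Q1 = Q2
flipQType Q2 = Q1
flipQType Q3 = Q3

flipReverses : QType → Bool
flipReverses Q1 = true
flipReverses Q2 = true
flipReverses Q3 = false

flipDir : Dir → Dir
flipDir up = down
flipDir down = up
flipDir left = left
flipDir right = right

flipIf-flip : ∀ q L dir →
  flipIf (flipReverses q) L (endIndex (side (flipQType q) dir) L) ≡ endIndex (side q (flipDir dir)) L
flipIf-flip Q1 L up = refl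
flipIf-flip Q1 L left = n∸n≡0 (L ∸ 1)
flipIf-flip Q1 L down = n∸n≡0 (L ∸ 1)
flipIf-flip Q1 L right = refl
flipIf-flip Q2 L up = refl
flipIf-flip Q2 L left = refl
flipIf-flip Q2 L down = n∸n≡0 (L ∸ 1)
flipIf-flip Q2 L right = n∸n≡0 (L ∸ 1)
flipIf-flip Q3 L up = refl
flipIf-flip Q3 L left = refl
flipIf-flip Q3 L down = refl
flipIf-flip Q3 L right = refl

∸-suc-involutive : ∀ {n i} → i < n → n ∸ suc (n ∸ suc i) ≡ i
∸-suc-involutive {n} i<n = trans (cong (n ∸_) (sym (∸-suc i<n))) (m∸[m∸n]≡n (<⇒≤ i<n))

module Flip {n b} (D : PGData (suc n) b) where
  mirror : Obj → Obj
  mirror (vx i j) = vx (n ∸ i) j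
  mirror (eh i j) = eh (n ∸ i) j
  mirror (ev i j) = ev (n ∸ suc i) j

  n∸i<1+n : ∀ i → n ∸ i < suc n
  n∸i<1+n i = s≤s (m∸n≤m n i)

  mirror-Deg4 : ∀ i j → Deg4 (suc n) b (n ∸ i) j → Deg4 (suc n) b i j
  mirror-Deg4 i j (p , q , r , s) =
    ∸-cancelʳ-< (≤-pred q) , s≤s (m∸n≢0⇒n<m (λ e → <-irrefl (sym e) p)) , r , s

  D′ : PGData (suc n) b
  D′ = record
    { len = λ μ → len D (mirror μ)
    ; qtype = λ i j → flipQType (qtype D (n ∸ i) j)
    ; len-vx = λ i j _ j<b → len-vx D (n ∸ i) j (n∸i<1+n i) j<b
    ; len-deg = λ i j _ j<b nd → len-deg D (n ∸ i) j (n∸i<1+n i) j<b (nd ∘ mirror-Deg4 i j) }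

  embed : PVtx → PVtx
  embed (vx i j , t) = (vx (n ∸ i) j , flipIf (flipReverses (qtype D (n ∸ i) j)) (len D (vx (n ∸ i) j)) t)
  embed (eh i j , t) = (eh (n ∸ i) j , t)
  embed (ev i j , t) = (ev (n ∸ suc i) j , len D (ev (n ∸ suc i) j) ∸ 1 ∸ t)

  proj : PVtx → PVtx
  proj (vx p j , t) = (vx (n ∸ p) j , flipIf (flipReverses (qtype D p j)) (len D (vx p j)) t)
  proj (eh p j , t) = (eh (n ∸ p) j , t)
  proj (ev p j , t) = (ev (n ∸ suc p) j , len D (ev p j) ∸ 1 ∸ t)

  proj-embed : ∀ x → IsVtx D′ x → proj (embed x) ≡ x
  proj-embed (vx i j , t) ((i<1+n , _) , t<) =
    cong₂ (λ p q → (vx p j , q)) (m∸[m∸n]≡n (≤-pred i<1+n)) (flipIf-involutive (flipReverses (qtype D (n ∸ i) j)) _ t t<)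
  proj-embed (eh i j , t) ((i<1+n , _) , _) = cong (λ p → (eh p j , t)) (m∸[m∸n]≡n (≤-pred i<1+n))
  proj-embed (ev i j , t) ((si<1+n , _) , t<) =
    cong₂ (λ p q → (ev p j , q)) (∸-suc-involutive (≤-pred si<1+n)) (flipIf-involutive true _ t t<)

  embed-IsVtx : ∀ x → IsVtx D′ x → IsVtx D (embed x)
  embed-IsVtx (vx i j , t) ((_ , j<b) , t<) = (n∸i<1+n i , j<b) , flipIf-< (flipReverses (qtype D (n ∸ i) j)) _ t t<
  embed-IsVtx (eh i j , t) ((_ , j<b) , t<) = (n∸i<1+n i , j<b) , t<
  embed-IsVtx (ev i j , t) ((si<1+n , j<b) , t<) = (s≤s (∸-suc-< i (≤-pred si<1+n)) , j<b) , flipIf-< true _ t t<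

  embed-attach : ∀ i j dir → embed (vx i j , attach D′ i j dir) ≡ (vx (n ∸ i) j , attach D (n ∸ i) j (flipDir dir))
  embed-attach i j dir = cong (vx (n ∸ i) j ,_) (begin
    flipIf rev L (attach D′ i j dir)                  ≡⟨ cong (flipIf rev L) (attach-endIndex D′ i j dir) ⟩
    flipIf rev L (endIndex (side (flipQType q) dir) L) ≡⟨ flipIf-flip q L dir ⟩
    endIndex (side q (flipDir dir)) L                 ≡⟨ sym (attach-endIndex D (n ∸ i) j (flipDir dir)) ⟩
    attach D (n ∸ i) j (flipDir dir)                  ∎)
    where
    open ≡-Reasoning
    q = qtype D (n ∸ i) j
    rev = flipReverses q
    L = len D (vx (n ∸ i) j)

  vWalk : ∀ i j → IsObj (suc n) b (ev i j) → Walk D (vRoute D′ embed i j) (suc (len D′ (ev i j)))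
  vWalk i j (si<1+n , j<b) =
    Walk-route-cong (trans (cong (λ z → (vx z j , attach D z j up)) (sym (∸-suc (≤-pred si<1+n)))) (sym (embed-attach i j down)))
      (λ _ → refl) (sym (embed-attach (suc i) j up))
      (Walk-route-reverse _ (λ t → (ev m j , t)) E _ (λ t → (ev m j , E ∸ 1 ∸ t)) (λ t _ → refl)
        (Walk-vRoute D m j (s≤s (∸-suc-< i (≤-pred si<1+n)) , j<b)))
    where
    m = n ∸ suc i
    E = len D (ev m j)

  contains : Contains D D′
  contains = mkContains D D′ embed embed-IsVtx proj proj-embed
    (λ i j t (_ , j<b) → flipIf-Adj D (flipReverses (qtype D (n ∸ i) j)) (vx (n ∸ i) j) t (n∸i<1+n i , j<b))
    (λ i j (_ , sj<b) → Walk-route-cong (sym (embed-attach i j right)) (λ _ → refl) (sym (embed-attach i (suc j) left))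
                          (Walk-hRoute D (n ∸ i) j (n∸i<1+n i , sj<b)))
    vWalk

  bottom-to-top : ∀ i {bo} → i + bo < suc n → bo ≤ n ∸ i
  bottom-to-top i {bo} q = m+n≤o⇒m≤o∸n bo (subst (_≤ n) (+-comm i bo) (≤-pred q))

  top-to-bottom : ∀ {i t} → t ≤ i → i ≤ n → (n ∸ i) + t < suc n
  top-to-bottom {i} t≤i i≤n = s≤s (≤-trans (+-monoʳ-≤ (n ∸ i) t≤i) (≤-reflexive (m∸n+n≡m i≤n)))

  embed-Inset : ∀ x {t bo l ri} → IsVtx D′ x → Inset (suc n) b t bo l ri (proj₁ x) →
    Inset (suc n) b bo t l ri (proj₁ (embed x))
  embed-Inset (vx i j , _) _ (p , q , r , s) = bottom-to-top i q , top-to-bottom p (≤-pred (m+n≤o⇒m≤o (suc i) q)) , r , s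
  embed-Inset (eh i j , _) _ (p , q , r , s) = bottom-to-top i q , top-to-bottom p (≤-pred (m+n≤o⇒m≤o (suc i) q)) , r , s
  embed-Inset (ev i j , _) {t} ((si<1+n , _) , _) (p , q , r , s) =
    bottom-to-top (suc i) q ,
    subst (λ z → z + t < suc n) (∸-suc (≤-pred si<1+n)) (top-to-bottom p (<⇒≤ (≤-pred si<1+n))) , r , s

-- Deleting a row: row i₀ + 1 is contracted into the vertical edges between rows i₀ and i₀ + 2.

module DeleteRow {a b} (i₀ : ℕ) (D : PGData (suc a) b) (i₀+1<a : suc i₀ < a) where
  I = suc i₀

  skip : ℕ → ℕ
  skip x with <-cmp x i₀
  ... | tri< _ _ _ = x
  ... | tri≈ _ _ _ = x
  ... | tri> _ _ _ = suc x

  skip-≤ : ∀ x → x ≤ i₀ → skip x ≡ x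
  skip-≤ x x≤i₀ with <-cmp x i₀
  ... | tri< _ _ _ = refl
  ... | tri≈ _ _ _ = refl
  ... | tri> _ _ i₀<x = ⊥-elim (<⇒≱ i₀<x x≤i₀)

  skip-> : ∀ x → i₀ < x → skip x ≡ suc x
  skip-> x i₀<x with <-cmp x i₀
  ... | tri< _ _ x≯i₀ = ⊥-elim (x≯i₀ i₀<x)
  ... | tri≈ _ _ x≯i₀ = ⊥-elim (x≯i₀ i₀<x)
  ... | tri> _ _ _ = refl

  skip-< : ∀ x → x < a → skip x < suc a
  skip-< x x<a with <-cmp x i₀
  ... | tri< _ _ _ = m≤n⇒m≤1+n x<a
  ... | tri≈ _ _ _ = m≤n⇒m≤1+n x<a
  ... | tri> _ _ _ = s≤s x<a

  skip≢I : ∀ x → skip x ≢ I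
  skip≢I x with <-cmp x i₀
  ... | tri< x<i₀ _ _ = λ e → <-irrefl e (m≤n⇒m≤1+n x<i₀)
  ... | tri≈ _ refl _ = λ e → <-irrefl e (n<1+n i₀)
  ... | tri> _ _ i₀<x = λ e → <-irrefl (sym (suc-injective e)) i₀<x

  ≤-skip : ∀ x → x ≤ skip x
  ≤-skip x with <-cmp x i₀
  ... | tri< _ _ _ = ≤-refl
  ... | tri≈ _ _ _ = ≤-refl
  ... | tri> _ _ _ = n≤1+n x

  skip-≤-suc : ∀ x → skip x ≤ suc x
  skip-≤-suc x with <-cmp x i₀
  ... | tri< _ _ _ = n≤1+n x
  ... | tri≈ _ _ _ = n≤1+n x
  ... | tri> _ _ _ = ≤-refl

  skip-Deg4 : ∀ x j → x < a → Deg4 (suc a) b (skip x) j → Deg4 a b x j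
  skip-Deg4 x j x<a (p , q , r , s) with <-cmp x i₀
  ... | tri< x<i₀ _ _ = p , <-trans (s≤s x<i₀) i₀+1<a , r , s
  ... | tri≈ _ refl _ = p , i₀+1<a , r , s
  ... | tri> _ _ i₀<x = ≤-<-trans z≤n i₀<x , ≤-pred q , r , s

  upperLen rowAttach lowerLen mergedLen : ℕ → ℕ
  upperLen j = len D (ev i₀ j)
  rowAttach j = attach D I j down
  lowerLen j = len D (ev I j)
  mergedLen j = upperLen j + (rowAttach j + suc (lowerLen j))

  upperStart upperEnd lowerStart lowerEnd : ℕ → PVtx
  upperStart j = (vx i₀ j , attach D i₀ j down)
  upperEnd j = (vx I j , attach D I j up)
  lowerStart j = (vx I j , rowAttach j)
  lowerEnd j = (vx (suc I) j , attach D (suc I) j up)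

  upperRoute alongRow lowerRoute belowUpper merged : ℕ → ℕ → PVtx
  upperRoute j = route (upperStart j) (λ t → (ev i₀ j , t)) (upperLen j) (upperEnd j)
  alongRow j k = (vx I j , k)
  lowerRoute j = route (lowerStart j) (λ t → (ev I j , t)) (lowerLen j) (lowerEnd j)
  belowUpper j = glue (rowAttach j) (alongRow j) (lowerRoute j)
  merged j = glue (suc (upperLen j)) (upperRoute j) (belowUpper j)

  lenOf : Obj → ℕ
  lenOf (vx x j) = len D (vx (skip x) j)
  lenOf (eh x j) = len D (eh (skip x) j)
  lenOf (ev x j) with <-cmp x i₀
  ... | tri< _ _ _ = len D (ev x j)
  ... | tri≈ _ _ _ = mergedLen j
  ... | tri> _ _ _ = len D (ev (suc x) j)

  D′ : PGData a b
  D′ = record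
    { len = lenOf
    ; qtype = λ x j → qtype D (skip x) j
    ; len-vx = λ x j x<a j<b → len-vx D (skip x) j (skip-< x x<a) j<b
    ; len-deg = λ x j x<a j<b nd → len-deg D (skip x) j (skip-< x x<a) j<b (nd ∘ skip-Deg4 x j x<a) }

  embed : PVtx → PVtx
  embed (vx x j , t) = (vx (skip x) j , t)
  embed (eh x j , t) = (eh (skip x) j , t)
  embed (ev x j , t) with <-cmp x i₀
  ... | tri< _ _ _ = (ev x j , t)
  ... | tri≈ _ _ _ = merged j (suc t)
  ... | tri> _ _ _ = (ev (suc x) j , t)

  proj : PVtx → PVtx
  proj (vx x j , t) with <-cmp x I
  ... | tri< _ _ _ = (vx x j , t)
  ... | tri≈ _ _ _ = (ev i₀ j , upperLen j + t)
  ... | tri> _ _ _ = (vx (pred x) j , t)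
  proj (eh x j , t) with <-cmp x I
  ... | tri> _ _ _ = (eh (pred x) j , t)
  ... | _ = (eh x j , t)
  proj (ev x j , t) with <-cmp x I
  ... | tri< _ _ _ = (ev x j , t)
  ... | tri≈ _ _ _ = (ev i₀ j , upperLen j + (rowAttach j + suc t))
  ... | tri> _ _ _ = (ev (pred x) j , t)

  merged-0 : ∀ j → merged j 0 ≡ upperStart j
  merged-0 j = glue-< (suc (upperLen j)) (upperRoute j) (belowUpper j) 0 (s≤s z≤n)

  merged-upper : ∀ j t → t < upperLen j → merged j (suc t) ≡ (ev i₀ j , t)
  merged-upper j t t< = trans (glue-< (suc (upperLen j)) (upperRoute j) (belowUpper j) (suc t) (s≤s t<))
                              (route-inner (upperStart j) (λ t → (ev i₀ j , t)) (upperLen j) (upperEnd j) t t<)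

  merged-below : ∀ j k → merged j (suc (upperLen j + k)) ≡ belowUpper j k
  merged-below j k = glue-+ (suc (upperLen j)) (upperRoute j) (belowUpper j) k

  merged-row : ∀ j k → k ≤ rowAttach j → merged j (suc (upperLen j + k)) ≡ (vx I j , k)
  merged-row j k k≤ = trans (merged-below j k) (glue-≤ (rowAttach j) (alongRow j) (lowerRoute j) k refl k≤)

  merged-lower : ∀ j m → m < lowerLen j → merged j (suc (upperLen j + (rowAttach j + suc m))) ≡ (ev I j , m)
  merged-lower j m m< = trans (merged-below j _) (trans (glue-+ (rowAttach j) (alongRow j) (lowerRoute j) (suc m))
                          (route-inner (lowerStart j) (λ t → (ev I j , t)) (lowerLen j) (lowerEnd j) m m<))

  merged-last : ∀ j → merged j (suc (mergedLen j)) ≡ lowerEnd j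
  merged-last j = trans (merged-below j _) (trans (glue-+ (rowAttach j) (alongRow j) (lowerRoute j) (suc (lowerLen j)))
                    (route-last (lowerStart j) (λ t → (ev I j , t)) (lowerLen j) (lowerEnd j)))

  rowAttach< : ∀ j → j < b → rowAttach j < len D (vx I j)
  rowAttach< j j<b = attach-< D I j down (m≤n⇒m≤1+n i₀+1<a) j<b

  Walk-merged : ∀ j → j < b → Walk D (merged j) (suc (mergedLen j))
  Walk-merged j j<b =
    Walk-glue (suc (upperLen j)) (rowAttach j + suc (lowerLen j)) (upperRoute j) (belowUpper j)
      (Walk-vRoute D i₀ j (s≤s (<-trans (n<1+n i₀) i₀+1<a) , j<b))
      (Walk-glue (rowAttach j) (suc (lowerLen j)) (alongRow j) (lowerRoute j)
        (λ k k< → inj₁ (inner (vx I j) k (m≤n⇒m≤1+n i₀+1<a , j<b) (≤-<-trans k< (rowAttach< j j<b))))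
        (Walk-vRoute D I j (s≤s i₀+1<a , j<b)) refl)
      (trans (route-last (upperStart j) (λ t → (ev i₀ j , t)) (upperLen j) (upperEnd j))
        (trans (cong (vx I j ,_) (attach-up D I j)) (sym (glue-≤ (rowAttach j) (alongRow j) (lowerRoute j) 0 refl z≤n))))

  data MergedPos (j t : ℕ) : Set where
    upper : t < upperLen j → MergedPos j t
    row   : ∀ k → k ≤ rowAttach j → t ≡ upperLen j + k → MergedPos j t
    lower : ∀ m → m < lowerLen j → t ≡ upperLen j + (rowAttach j + suc m) → MergedPos j t

  mergedPos : ∀ j t → t < mergedLen j → MergedPos j t
  mergedPos j t t< with t <? upperLen j
  ... | yes t<u = upper t<u
  ... | no t≮u with t ∸ upperLen j ≤? rowAttach j
  ...   | yes k≤ = row (t ∸ upperLen j) k≤ (sym (m+[n∸m]≡n (≮⇒≥ t≮u)))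
  ...   | no k≰ = lower m m< t≡
    where
    k = t ∸ upperLen j
    m = k ∸ suc (rowAttach j)
    t≡ : t ≡ upperLen j + (rowAttach j + suc m)
    t≡ = trans (sym (m+[n∸m]≡n (≮⇒≥ t≮u)))
               (cong (upperLen j +_) (trans (sym (m+[n∸m]≡n (≰⇒> k≰))) (sym (+-suc (rowAttach j) m))))
    m< : m < lowerLen j
    m< = ≤-pred (+-cancelˡ-< (rowAttach j) (suc m) (suc (lowerLen j))
           (+-cancelˡ-< (upperLen j) (rowAttach j + suc m) (rowAttach j + suc (lowerLen j)) (subst (_< mergedLen j) t≡ t<)))

  rowPred : Obj → Obj
  rowPred (vx x j) = vx (pred x) j
  rowPred (eh x j) = eh (pred x) j
  rowPred (ev x j) = ev (pred x) j

  proj-above : ∀ μ t → rowMin μ < I → proj (μ , t) ≡ (μ , t)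
  proj-above (vx x j) t x<I with <-cmp x I
  ... | tri< _ _ _ = refl
  ... | tri≈ _ x≡I _ = ⊥-elim (<-irrefl x≡I x<I)
  ... | tri> _ _ x>I = ⊥-elim (<-asym x<I x>I)
  proj-above (eh x j) t x<I with <-cmp x I
  ... | tri< _ _ _ = refl
  ... | tri≈ _ x≡I _ = ⊥-elim (<-irrefl x≡I x<I)
  ... | tri> _ _ x>I = ⊥-elim (<-asym x<I x>I)
  proj-above (ev x j) t x<I with <-cmp x I
  ... | tri< _ _ _ = refl
  ... | tri≈ _ x≡I _ = ⊥-elim (<-irrefl x≡I x<I)
  ... | tri> _ _ x>I = ⊥-elim (<-asym x<I x>I)

  proj-below : ∀ μ t → I < rowMin μ → proj (μ , t) ≡ (rowPred μ , t)
  proj-below (vx x j) t I<x with <-cmp x I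
  ... | tri< x<I _ _ = ⊥-elim (<-asym x<I I<x)
  ... | tri≈ _ x≡I _ = ⊥-elim (<-irrefl (sym x≡I) I<x)
  ... | tri> _ _ _ = refl
  proj-below (eh x j) t I<x with <-cmp x I
  ... | tri< x<I _ _ = ⊥-elim (<-asym x<I I<x)
  ... | tri≈ _ x≡I _ = ⊥-elim (<-irrefl (sym x≡I) I<x)
  ... | tri> _ _ _ = refl
  proj-below (ev x j) t I<x with <-cmp x I
  ... | tri< x<I _ _ = ⊥-elim (<-asym x<I I<x)
  ... | tri≈ _ x≡I _ = ⊥-elim (<-irrefl (sym x≡I) I<x)
  ... | tri> _ _ _ = refl

  proj-row : ∀ j t → proj (vx I j , t) ≡ (ev i₀ j , upperLen j + t)
  proj-row j t with <-cmp I I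
  ... | tri< I<I _ _ = ⊥-elim (<-irrefl refl I<I)
  ... | tri≈ _ _ _ = refl
  ... | tri> _ _ I>I = ⊥-elim (<-irrefl refl I>I)

  proj-lower : ∀ j t → proj (ev I j , t) ≡ (ev i₀ j , upperLen j + (rowAttach j + suc t))
  proj-lower j t with <-cmp I I
  ... | tri< I<I _ _ = ⊥-elim (<-irrefl refl I<I)
  ... | tri≈ _ _ _ = refl
  ... | tri> _ _ I>I = ⊥-elim (<-irrefl refl I>I)

  merged-IsVtx : ∀ j t → j < b → MergedPos j t → IsVtx D (merged j (suc t))
  merged-IsVtx j t j<b (upper t<) =
    subst (IsVtx D) (sym (merged-upper j t t<)) ((s≤s (<-trans (n<1+n i₀) i₀+1<a) , j<b) , t<)
  merged-IsVtx j _ j<b (row k k≤ refl) =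
    subst (IsVtx D) (sym (merged-row j k k≤)) ((m≤n⇒m≤1+n i₀+1<a , j<b) , ≤-<-trans k≤ (rowAttach< j j<b))
  merged-IsVtx j _ j<b (lower m m< refl) =
    subst (IsVtx D) (sym (merged-lower j m m<)) ((s≤s i₀+1<a , j<b) , m<)

  proj-merged : ∀ j t → MergedPos j t → proj (merged j (suc t)) ≡ (ev i₀ j , t)
  proj-merged j t (upper t<) = trans (cong proj (merged-upper j t t<)) (proj-above (ev i₀ j) t (n<1+n i₀))
  proj-merged j _ (row k k≤ refl) = trans (cong proj (merged-row j k k≤)) (proj-row j k)
  proj-merged j _ (lower m m< refl) = trans (cong proj (merged-lower j m m<)) (proj-lower j m)

  merged-not-eh : ∀ j t j′ → MergedPos j t → proj₁ (merged j (suc t)) ≢ eh I j′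
  merged-not-eh j t j′ (upper t<) e with trans (sym (cong proj₁ (merged-upper j t t<))) e
  ... | ()
  merged-not-eh j _ j′ (row k k≤ refl) e with trans (sym (cong proj₁ (merged-row j k k≤))) e
  ... | ()
  merged-not-eh j _ j′ (lower m m< refl) e with trans (sym (cong proj₁ (merged-lower j m m<))) e
  ... | ()

  merged-bounds : ∀ j t → MergedPos j t → let μ = proj₁ (merged j (suc t)) in
    i₀ ≤ rowMin μ × rowMax μ ≤ suc I × j ≤ colMin μ × colMax μ ≤ j
  merged-bounds j t (upper t<) rewrite merged-upper j t t< = ≤-refl , n≤1+n _ , ≤-refl , ≤-refl
  merged-bounds j _ (row k k≤ refl) rewrite merged-row j k k≤ = n≤1+n _ , n≤1+n _ , ≤-refl , ≤-refl
  merged-bounds j _ (lower m m< refl) rewrite merged-lower j m m< = n≤1+n _ , ≤-refl , ≤-refl , ≤-refl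

  embed-attach : ∀ x j dir → embed (vx x j , attach D′ x j dir) ≡ (vx (skip x) j , attach D (skip x) j dir)
  embed-attach x j dir = cong (vx (skip x) j ,_) (trans (attach-endIndex D′ x j dir) (sym (attach-endIndex D (skip x) j dir)))

  embed-attach-≤ : ∀ x j dir → x ≤ i₀ → embed (vx x j , attach D′ x j dir) ≡ (vx x j , attach D x j dir)
  embed-attach-≤ x j dir x≤ = trans (embed-attach x j dir) (cong (λ z → (vx z j , attach D z j dir)) (skip-≤ x x≤))

  embed-attach-> : ∀ x j dir → i₀ < x → embed (vx x j , attach D′ x j dir) ≡ (vx (suc x) j , attach D (suc x) j dir)
  embed-attach-> x j dir x> = trans (embed-attach x j dir) (cong (λ z → (vx z j , attach D z j dir)) (skip-> x x>))

  ev-above : ∀ x j → x < i₀ → (∀ t → embed (ev x j , t) ≡ (ev x j , t)) × lenOf (ev x j) ≡ len D (ev x j)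
  ev-above x j x<i₀ with <-cmp x i₀
  ... | tri< _ _ _ = (λ _ → refl) , refl
  ... | tri≈ _ x≡i₀ _ = ⊥-elim (<-irrefl x≡i₀ x<i₀)
  ... | tri> _ _ x>i₀ = ⊥-elim (<-asym x<i₀ x>i₀)

  ev-merged : ∀ j → (∀ t → embed (ev i₀ j , t) ≡ merged j (suc t)) × lenOf (ev i₀ j) ≡ mergedLen j
  ev-merged j with <-cmp i₀ i₀
  ... | tri< i₀<i₀ _ _ = ⊥-elim (<-irrefl refl i₀<i₀)
  ... | tri≈ _ _ _ = (λ _ → refl) , refl
  ... | tri> _ _ i₀>i₀ = ⊥-elim (<-irrefl refl i₀>i₀)

  ev-below : ∀ x j → i₀ < x → (∀ t → embed (ev x j , t) ≡ (ev (suc x) j , t)) × lenOf (ev x j) ≡ len D (ev (suc x) j)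
  ev-below x j i₀<x with <-cmp x i₀
  ... | tri< x<i₀ _ _ = ⊥-elim (<-asym x<i₀ i₀<x)
  ... | tri≈ _ x≡i₀ _ = ⊥-elim (<-irrefl (sym x≡i₀) i₀<x)
  ... | tri> _ _ _ = (λ _ → refl) , refl

  vRoute-Walk-cong : ∀ x j {f n} → (∀ t → f t ≡ embed (ev x j , t)) → n ≡ len D′ (ev x j) →
    Walk D (route (embed (vx x j , attach D′ x j down)) f n (embed (vx (suc x) j , attach D′ (suc x) j up))) (suc n) →
    Walk D (vRoute D′ embed x j) (suc (len D′ (ev x j)))
  vRoute-Walk-cong x j f≡ refl = Walk-route-cong refl f≡ refl

  vWalk : ∀ x j → IsObj a b (ev x j) → Walk D (vRoute D′ embed x j) (suc (len D′ (ev x j)))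
  vWalk x j (sx<a , j<b) = byRow (<-cmp x i₀)
    where
    byRow : Tri (x < i₀) (x ≡ i₀) (i₀ < x) → Walk D (vRoute D′ embed x j) (suc (len D′ (ev x j)))
    byRow (tri< x<i₀ _ _) = let (embed≡ , len≡) = ev-above x j x<i₀ in
      vRoute-Walk-cong x j (sym ∘ embed≡) (sym len≡)
        (Walk-route-cong (sym (embed-attach-≤ x j down (<⇒≤ x<i₀))) (λ _ → refl) (sym (embed-attach-≤ (suc x) j up x<i₀))
          (Walk-vRoute D x j (m≤n⇒m≤1+n sx<a , j<b)))
    byRow (tri≈ _ refl _) = let (embed≡ , len≡) = ev-merged j in
      vRoute-Walk-cong i₀ j (sym ∘ embed≡) (sym len≡)
        (Walk-cong (suc (mergedLen j))
          (route-unique (merged j) _ (mergedLen j) _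
            (trans (merged-0 j) (sym (embed-attach-≤ i₀ j down ≤-refl)))
            (trans (merged-last j) (sym (embed-attach-> I j up (n<1+n i₀)))))
          (Walk-merged j j<b))
    byRow (tri> _ _ i₀<x) = let (embed≡ , len≡) = ev-below x j i₀<x in
      vRoute-Walk-cong x j (sym ∘ embed≡) (sym len≡)
        (Walk-route-cong (sym (embed-attach-> x j down i₀<x)) (λ _ → refl) (sym (embed-attach-> (suc x) j up (m≤n⇒m≤1+n i₀<x)))
          (Walk-vRoute D (suc x) j (s≤s sx<a , j<b)))

  embed-IsVtx : ∀ x → IsVtx D′ x → IsVtx D (embed x)
  embed-IsVtx (vx x j , t) ((x<a , j<b) , t<) = (skip-< x x<a , j<b) , t<
  embed-IsVtx (eh x j , t) ((x<a , j<b) , t<) = (skip-< x x<a , j<b) , t<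
  embed-IsVtx (ev x j , t) ((sx<a , j<b) , t<) = byRow (<-cmp x i₀)
    where
    byRow : Tri (x < i₀) (x ≡ i₀) (i₀ < x) → IsVtx D (embed (ev x j , t))
    byRow (tri< x<i₀ _ _) = let (embed≡ , len≡) = ev-above x j x<i₀ in
      subst (IsVtx D) (sym (embed≡ t)) ((<-trans sx<a (n<1+n a) , j<b) , subst (t <_) len≡ t<)
    byRow (tri≈ _ refl _) = let (embed≡ , len≡) = ev-merged j in
      subst (IsVtx D) (sym (embed≡ t)) (merged-IsVtx j t j<b (mergedPos j t (subst (t <_) len≡ t<)))
    byRow (tri> _ _ i₀<x) = let (embed≡ , len≡) = ev-below x j i₀<x in
      subst (IsVtx D) (sym (embed≡ t)) ((s≤s sx<a , j<b) , subst (t <_) len≡ t<)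

  proj-embed : ∀ x → IsVtx D′ x → proj (embed x) ≡ x
  proj-embed (vx x j , t) _ with x ≤? i₀
  ... | yes x≤ = trans (cong (λ z → proj (vx z j , t)) (skip-≤ x x≤)) (proj-above (vx x j) t (s≤s x≤))
  ... | no x≰ = trans (cong (λ z → proj (vx z j , t)) (skip-> x (≰⇒> x≰))) (proj-below (vx (suc x) j) t (s≤s (≰⇒> x≰)))
  proj-embed (eh x j , t) _ with x ≤? i₀
  ... | yes x≤ = trans (cong (λ z → proj (eh z j , t)) (skip-≤ x x≤)) (proj-above (eh x j) t (s≤s x≤))
  ... | no x≰ = trans (cong (λ z → proj (eh z j , t)) (skip-> x (≰⇒> x≰))) (proj-below (eh (suc x) j) t (s≤s (≰⇒> x≰)))
  proj-embed (ev x j , t) ((_ , _) , t<) = byRow (<-cmp x i₀)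
    where
    byRow : Tri (x < i₀) (x ≡ i₀) (i₀ < x) → proj (embed (ev x j , t)) ≡ (ev x j , t)
    byRow (tri< x<i₀ _ _) = trans (cong proj (proj₁ (ev-above x j x<i₀) t)) (proj-above (ev x j) t (m≤n⇒m≤1+n x<i₀))
    byRow (tri≈ _ refl _) = let (embed≡ , len≡) = ev-merged j in
      trans (cong proj (embed≡ t)) (proj-merged j t (mergedPos j t (subst (t <_) len≡ t<)))
    byRow (tri> _ _ i₀<x) = trans (cong proj (proj₁ (ev-below x j i₀<x) t)) (proj-below (ev (suc x) j) t (s≤s i₀<x))

  contains : Contains D D′
  contains = mkContains D D′ embed embed-IsVtx proj proj-embed
    (λ x j t (x<a , j<b) → inj₁ ∘ inner (vx (skip x) j) t (skip-< x x<a , j<b))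
    (λ x j (x<a , sj<b) → Walk-route-cong (sym (embed-attach x j right)) (λ _ → refl) (sym (embed-attach x (suc j) left))
                            (Walk-hRoute D (skip x) j (skip-< x x<a , sj<b)))
    vWalk

  shrinkObj : Obj → Obj
  shrinkObj μ = proj₁ (proj (μ , 0))

  proj-obj : ∀ μ t → proj₁ (proj (μ , t)) ≡ shrinkObj μ
  proj-obj (vx x j) t with <-cmp x I
  ... | tri< _ _ _ = refl
  ... | tri≈ _ _ _ = refl
  ... | tri> _ _ _ = refl
  proj-obj (eh x j) t with <-cmp x I
  ... | tri< _ _ _ = refl
  ... | tri≈ _ _ _ = refl
  ... | tri> _ _ _ = refl
  proj-obj (ev x j) t with <-cmp x I
  ... | tri< _ _ _ = refl
  ... | tri≈ _ _ _ = refl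
  ... | tri> _ _ _ = refl

  shrinkObj-embed : ∀ x → IsVtx D′ x → shrinkObj (proj₁ (embed x)) ≡ proj₁ x
  shrinkObj-embed x v = trans (sym (proj-obj (proj₁ (embed x)) (proj₂ (embed x)))) (cong proj₁ (proj-embed x v))

  embed-avoids-row : ∀ x → IsVtx D′ x → ∀ j′ → proj₁ (embed x) ≢ eh I j′
  embed-avoids-row (vx x j , t) _ j′ ()
  embed-avoids-row (eh x j , t) _ j′ e = skip≢I x (cong rowMin e)
  embed-avoids-row (ev x j , t) ((_ , _) , t<) j′ = byRow (<-cmp x i₀)
    where
    byRow : Tri (x < i₀) (x ≡ i₀) (i₀ < x) → proj₁ (embed (ev x j , t)) ≢ eh I j′
    byRow (tri< x<i₀ _ _) e with trans (sym (cong proj₁ (proj₁ (ev-above x j x<i₀) t))) e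
    ... | ()
    byRow (tri≈ _ refl _) = let (embed≡ , len≡) = ev-merged j in
      λ e → merged-not-eh j t j′ (mergedPos j t (subst (t <_) len≡ t<)) (trans (sym (cong proj₁ (embed≡ t))) e)
    byRow (tri> _ _ i₀<x) e with trans (sym (cong proj₁ (proj₁ (ev-below x j i₀<x) t))) e
    ... | ()

  embed-Inset : ∀ x {t bo l ri} → IsVtx D′ x → Inset a b t bo l ri (proj₁ x) → Inset (suc a) b t bo l ri (proj₁ (embed x))
  embed-Inset (vx x j , _) _ B = Inset-shift 0 (vx x j) (vx (skip x) j) B (≤-skip x) (skip-≤-suc x) ≤-refl ≤-refl
  embed-Inset (eh x j , _) _ B = Inset-shift 0 (eh x j) (eh (skip x) j) B (≤-skip x) (skip-≤-suc x) ≤-refl ≤-refl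
  embed-Inset (ev x j , t) {t′} {bo} {l} {ri} ((_ , _) , t<) B = byRow (<-cmp x i₀)
    where
    byRow : Tri (x < i₀) (x ≡ i₀) (i₀ < x) → Inset (suc a) b t′ bo l ri (proj₁ (embed (ev x j , t)))
    byRow (tri< x<i₀ _ _) rewrite proj₁ (ev-above x j x<i₀) t = Inset-shift 0 (ev x j) (ev x j) B ≤-refl (n≤1+n _) ≤-refl ≤-refl
    byRow (tri≈ _ refl _) = let (embed≡ , len≡) = ev-merged j in
      let (p , q , r , u) = merged-bounds j t (mergedPos j t (subst (t <_) len≡ t<)) in
      subst (λ y → Inset (suc a) b t′ bo l ri (proj₁ y)) (sym (embed≡ t))
        (Inset-shift 0 (ev i₀ j) (proj₁ (merged j (suc t))) B p q r u)
    byRow (tri> _ _ i₀<x) rewrite proj₁ (ev-below x j i₀<x) t = Inset-shift 0 (ev x j) (ev (suc x) j) B (n≤1+n x) ≤-refl ≤-refl ≤-refl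

-- Peeling off the top row: the new top vertex in column j is the q-end of P_(1,j), and the
-- new edges leaving it run along P_(1,j) to where the old edges were attached.

distFromQ : End → ℕ → ℕ
distFromQ pEnd L = L ∸ 1
distFromQ qEnd L = 0

distFromQ-≤ : ∀ e L → distFromQ e L ≤ L ∸ 1
distFromQ-≤ pEnd L = ≤-refl
distFromQ-≤ qEnd L = z≤n

endIndex-from-q : ∀ e L → L ∸ 1 ∸ distFromQ e L ≡ endIndex e L
endIndex-from-q pEnd L = n∸n≡0 (L ∸ 1)
endIndex-from-q qEnd L = refl

endIndex+distFromQ : ∀ e L → endIndex e L + distFromQ e L ≡ L ∸ 1
endIndex+distFromQ pEnd L = refl
endIndex+distFromQ qEnd L = +-identityʳ (L ∸ 1)

distFromQ-pos : ∀ e L → 0 < distFromQ e L → e ≡ pEnd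
distFromQ-pos pEnd L _ = refl
distFromQ-pos qEnd L ()

right-at-p : ∀ q → side q right ≡ pEnd → q ≡ Q2
right-at-p Q2 _ = refl

left-at-p : ∀ q → side q left ≡ pEnd → q ≡ Q1
left-at-p Q1 _ = refl

down-at-p : ∀ q → side q down ≡ pEnd → q ≡ Q3
down-at-p Q3 _ = refl

<-+-split : ∀ n m t → t < n + m → t < n ⊎ ∃ λ e → e < m × t ≡ n + e
<-+-split n m t t< with t <? n
... | yes t<n = inj₁ t<n
... | no t≮n = inj₂ (t ∸ n , +-cancelˡ-< n (t ∸ n) m (subst (_< n + m) (sym t≡) t<) , sym t≡)
  where
  t≡ : n + (t ∸ n) ≡ t
  t≡ = m+[n∸m]≡n (≮⇒≥ t≮n)

module PeelTop {a b} (D : PGData (suc a) b) where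
  rowLen hLen vLen : ℕ → ℕ
  rowLen j = len D (vx 1 j)
  hLen j = len D (eh 1 j)
  vLen j = len D (ev 1 j)

  side₁ : ℕ → Dir → End
  side₁ j dir = side (qtype D 1 j) dir

  toRight toLeft toDown : ℕ → ℕ
  toRight j = distFromQ (side₁ j right) (rowLen j)
  toLeft j = distFromQ (side₁ j left) (rowLen j)
  toDown j = distFromQ (side₁ j down) (rowLen j)

  descend ascend topH topV : ℕ → ℕ → PVtx
  descend j k = (vx 1 j , rowLen j ∸ 1 ∸ k)
  ascend j k = (vx 1 (suc j) , attach D 1 (suc j) left + k)
  topH j = glue (toRight j) (descend j) (glue (suc (hLen j)) (hRoute D (λ x → x) 1 j) (ascend j))
  topV j = glue (toDown j) (descend j) (vRoute D (λ x → x) 1 j)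

  topHLen topVLen : ℕ → ℕ
  topHLen j = toRight j + (hLen j + toLeft (suc j))
  topVLen j = toDown j + vLen j

  lenOf : Obj → ℕ
  lenOf (vx zero j) = 1
  lenOf (vx (suc x) j) = len D (vx (suc (suc x)) j)
  lenOf (eh zero j) = topHLen j
  lenOf (eh (suc x) j) = len D (eh (suc (suc x)) j)
  lenOf (ev zero j) = topVLen j
  lenOf (ev (suc x) j) = len D (ev (suc (suc x)) j)

  qtypeOf : ℕ → ℕ → QType
  qtypeOf zero j = Q1
  qtypeOf (suc x) j = qtype D (suc (suc x)) j

  D′ : PGData a b
  D′ = record { len = lenOf ; qtype = qtypeOf ; len-vx = len-vx′ ; len-deg = len-deg′ }
    where
    len-vx′ : ∀ x j → x < a → j < b → 1 ≤ lenOf (vx x j)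
    len-vx′ zero j _ _ = ≤-refl
    len-vx′ (suc x) j x<a j<b = len-vx D (suc (suc x)) j (s≤s x<a) j<b
    len-deg′ : ∀ x j → x < a → j < b → ¬ Deg4 a b x j → lenOf (vx x j) ≡ 1
    len-deg′ zero j _ _ _ = refl
    len-deg′ (suc x) j x<a j<b nd =
      len-deg D (suc (suc x)) j (s≤s x<a) j<b (λ { (p , q , r , t) → nd (s≤s z≤n , ≤-pred q , r , t) })

  embed : PVtx → PVtx
  embed (vx zero j , t) = (vx 1 j , rowLen j ∸ 1)
  embed (vx (suc x) j , t) = (vx (suc (suc x)) j , t)
  embed (eh zero j , t) = topH j (suc t)
  embed (eh (suc x) j , t) = (eh (suc (suc x)) j , t)
  embed (ev zero j , t) = topV j (suc t)
  embed (ev (suc x) j , t) = (ev (suc (suc x)) j , t)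

  -- The vertices of P_(1,j) other than its q-end, sorted by the new edge whose route uses them.
  pieceOf : ℕ → ℕ → QType → PVtx
  pieceOf j t Q1 = (eh 0 (pred j) , toRight (pred j) + (hLen (pred j) + t))
  pieceOf j t Q2 = (eh 0 j , rowLen j ∸ 1 ∸ 1 ∸ t)
  pieceOf j t Q3 = (ev 0 j , rowLen j ∸ 1 ∸ 1 ∸ t)

  proj : PVtx → PVtx
  proj (vx zero j , t) = (vx zero j , t)
  proj (vx (suc zero) j , t) with t ≟ rowLen j ∸ 1
  ... | yes _ = (vx 0 j , 0)
  ... | no _ = pieceOf j t (qtype D 1 j)
  proj (vx (suc (suc x)) j , t) = (vx (suc x) j , t)
  proj (eh zero j , t) = (eh zero j , t)
  proj (eh (suc zero) j , t) = (eh 0 j , toRight j + t)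
  proj (eh (suc (suc x)) j , t) = (eh (suc x) j , t)
  proj (ev zero j , t) = (ev zero j , t)
  proj (ev (suc zero) j , t) = (ev 0 j , toDown j + t)
  proj (ev (suc (suc x)) j , t) = (ev (suc x) j , t)

  proj-top : ∀ j → proj (vx 1 j , rowLen j ∸ 1) ≡ (vx 0 j , 0)
  proj-top j with (rowLen j ∸ 1) ≟ rowLen j ∸ 1
  ... | yes _ = refl
  ... | no ne = ⊥-elim (ne refl)

  proj-piece : ∀ j t → t ≢ rowLen j ∸ 1 → proj (vx 1 j , t) ≡ pieceOf j t (qtype D 1 j)
  proj-piece j t ne with t ≟ rowLen j ∸ 1
  ... | yes e = ⊥-elim (ne e)
  ... | no _ = refl

  descend-attach : ∀ j dir → descend j (distFromQ (side₁ j dir) (rowLen j)) ≡ (vx 1 j , attach D 1 j dir)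
  descend-attach j dir = cong (vx 1 j ,_) (trans (endIndex-from-q (side₁ j dir) (rowLen j)) (sym (attach-endIndex D 1 j dir)))

  attach-left+toLeft : ∀ j → attach D 1 j left + toLeft j ≡ rowLen j ∸ 1
  attach-left+toLeft j = trans (cong (_+ toLeft j) (attach-endIndex D 1 j left)) (endIndex+distFromQ (side₁ j left) (rowLen j))

  hPart : ℕ → ℕ → PVtx
  hPart j = glue (suc (hLen j)) (hRoute D (λ x → x) 1 j) (ascend j)

  topH-descend : ∀ j k → k ≤ toRight j → topH j k ≡ descend j k
  topH-descend j k k≤ =
    glue-≤ (toRight j) (descend j) (hPart j) k
      (trans (descend-attach j right) (sym (glue-< (suc (hLen j)) (hRoute D (λ x → x) 1 j) (ascend j) 0 (s≤s z≤n)))) k≤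

  topH-after : ∀ j m → topH j (suc (toRight j + m)) ≡ hPart j (suc m)
  topH-after j m = trans (cong (topH j) (sym (+-suc (toRight j) m))) (glue-+ (toRight j) (descend j) (hPart j) (suc m))

  topH-edge : ∀ j e → e < hLen j → topH j (suc (toRight j + e)) ≡ (eh 1 j , e)
  topH-edge j e e< = trans (topH-after j e)
    (trans (glue-< (suc (hLen j)) (hRoute D (λ x → x) 1 j) (ascend j) (suc e) (s≤s e<))
           (route-inner (vx 1 j , attach D 1 j right) (λ t → (eh 1 j , t)) (hLen j) (vx 1 (suc j) , attach D 1 (suc j) left) e e<))

  topH-ascend : ∀ j f → topH j (suc (toRight j + (hLen j + f))) ≡ ascend j f
  topH-ascend j f = trans (topH-after j (hLen j + f)) (glue-+ (suc (hLen j)) (hRoute D (λ x → x) 1 j) (ascend j) f)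

  topH-last : ∀ j → topH j (suc (topHLen j)) ≡ (vx 1 (suc j) , rowLen (suc j) ∸ 1)
  topH-last j = trans (topH-ascend j (toLeft (suc j))) (cong (vx 1 (suc j) ,_) (attach-left+toLeft (suc j)))

  topV-descend : ∀ j k → k ≤ toDown j → topV j k ≡ descend j k
  topV-descend j k k≤ = glue-≤ (toDown j) (descend j) (vRoute D (λ x → x) 1 j) k (descend-attach j down) k≤

  topV-edge : ∀ j e → e < vLen j → topV j (suc (toDown j + e)) ≡ (ev 1 j , e)
  topV-edge j e e< = trans (cong (topV j) (sym (+-suc (toDown j) e)))
    (trans (glue-+ (toDown j) (descend j) (vRoute D (λ x → x) 1 j) (suc e))
           (route-inner (vx 1 j , attach D 1 j down) (λ t → (ev 1 j , t)) (vLen j) (vx 2 j , attach D 2 j up) e e<))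

  topV-last : ∀ j → topV j (suc (topVLen j)) ≡ (vx 2 j , attach D 2 j up)
  topV-last j = trans (cong (topV j) (sym (+-suc (toDown j) (vLen j))))
    (trans (glue-+ (toDown j) (descend j) (vRoute D (λ x → x) 1 j) (suc (vLen j)))
           (route-last (vx 1 j , attach D 1 j down) (λ t → (ev 1 j , t)) (vLen j) (vx 2 j , attach D 2 j up)))

  rowLen-pos : ∀ j → 0 < a → j < b → 1 ≤ rowLen j
  rowLen-pos j 0<a j<b = len-vx D 1 j (s≤s 0<a) j<b

  Walk-descend : ∀ j n → 0 < a → j < b → n ≤ rowLen j ∸ 1 → Walk D (descend j) n
  Walk-descend j n 0<a j<b n≤ k k<n =
    flipIf-Adj D true (vx 1 j) k (s≤s 0<a , j<b) (≤-<-trans (≤-trans k<n n≤) (n∸1<n (rowLen-pos j 0<a j<b)))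

  Walk-ascend : ∀ j → 0 < a → suc j < b → Walk D (ascend j) (toLeft (suc j))
  Walk-ascend j 0<a sj<b k k< = inj₁ (subst (λ z → Link D (vx 1 (suc j) , c + k) (vx 1 (suc j) , z)) (sym (+-suc c k))
    (inner (vx 1 (suc j)) (c + k) (s≤s 0<a , sj<b) (≤-<-trans c+k< (n∸1<n (rowLen-pos (suc j) 0<a sj<b)))))
    where
    c = attach D 1 (suc j) left
    c+k< : suc (c + k) ≤ rowLen (suc j) ∸ 1
    c+k< = ≤-trans (≤-reflexive (sym (+-suc c k))) (≤-trans (+-monoʳ-≤ c k<) (≤-reflexive (attach-left+toLeft (suc j))))

  Walk-topH : ∀ j → 0 < a → suc j < b → Walk D (topH j) (suc (topHLen j))
  Walk-topH j 0<a sj<b = subst (Walk D (topH j)) (+-suc (toRight j) (hLen j + toLeft (suc j)))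
    (Walk-glue (toRight j) (suc (hLen j) + toLeft (suc j)) (descend j) (hPart j)
      (Walk-descend j (toRight j) 0<a (<-trans (n<1+n j) sj<b) (distFromQ-≤ (side₁ j right) (rowLen j)))
      (Walk-glue (suc (hLen j)) (toLeft (suc j)) (hRoute D (λ x → x) 1 j) (ascend j)
        (Walk-hRoute D 1 j (s≤s 0<a , sj<b)) (Walk-ascend j 0<a sj<b)
        (trans (route-last (vx 1 j , attach D 1 j right) (λ t → (eh 1 j , t)) (hLen j) (vx 1 (suc j) , attach D 1 (suc j) left))
               (cong (vx 1 (suc j) ,_) (sym (+-identityʳ _)))))
      (trans (descend-attach j right) (sym (glue-< (suc (hLen j)) (hRoute D (λ x → x) 1 j) (ascend j) 0 (s≤s z≤n)))))

  Walk-topV : ∀ j → 1 < a → j < b → Walk D (topV j) (suc (topVLen j))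
  Walk-topV j 1<a j<b = subst (Walk D (topV j)) (+-suc (toDown j) (vLen j))
    (Walk-glue (toDown j) (suc (vLen j)) (descend j) (vRoute D (λ x → x) 1 j)
      (Walk-descend j (toDown j) (<-trans (s≤s z≤n) 1<a) j<b (distFromQ-≤ (side₁ j down) (rowLen j)))
      (Walk-vRoute D 1 j (s≤s 1<a , j<b)) (descend-attach j down))

  embed-attach : ∀ x j dir → embed (vx (suc x) j , attach D′ (suc x) j dir) ≡ (vx (suc (suc x)) j , attach D (suc (suc x)) j dir)
  embed-attach x j dir = cong (vx (suc (suc x)) j ,_)
    (trans (attach-endIndex D′ (suc x) j dir) (sym (attach-endIndex D (suc (suc x)) j dir)))

  hWalk : ∀ x j → IsObj a b (eh x j) → Walk D (hRoute D′ embed x j) (suc (len D′ (eh x j)))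
  hWalk zero j (0<a , sj<b) =
    Walk-cong (suc (topHLen j)) (route-unique (topH j) _ (topHLen j) _ (topH-descend j 0 z≤n) (topH-last j))
      (Walk-topH j 0<a sj<b)
  hWalk (suc x) j (x<a , sj<b) =
    Walk-route-cong (sym (embed-attach x j right)) (λ _ → refl) (sym (embed-attach x (suc j) left))
      (Walk-hRoute D (suc (suc x)) j (s≤s x<a , sj<b))

  vWalk : ∀ x j → IsObj a b (ev x j) → Walk D (vRoute D′ embed x j) (suc (len D′ (ev x j)))
  vWalk zero j (1<a , j<b) =
    Walk-cong (suc (topVLen j))
      (route-unique (topV j) _ (topVLen j) _ (topV-descend j 0 z≤n) (trans (topV-last j) (sym (embed-attach 0 j up))))
      (Walk-topV j 1<a j<b)
  vWalk (suc x) j (sx<a , j<b) =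
    Walk-route-cong (sym (embed-attach x j down)) (λ _ → refl) (sym (embed-attach (suc x) j up))
      (Walk-vRoute D (suc (suc x)) j (s≤s sx<a , j<b))

  data TopHPos (j t : ℕ) : Set where
    descending : t < toRight j → TopHPos j t
    edge       : ∀ e → e < hLen j → t ≡ toRight j + e → TopHPos j t
    ascending  : ∀ f → f < toLeft (suc j) → t ≡ toRight j + (hLen j + f) → TopHPos j t

  topHPos : ∀ j t → t < topHLen j → TopHPos j t
  topHPos j t t< with <-+-split (toRight j) (hLen j + toLeft (suc j)) t t<
  ... | inj₁ t<r = descending t<r
  ... | inj₂ (e , e< , t≡) with <-+-split (hLen j) (toLeft (suc j)) e e<
  ...   | inj₁ e<h = edge e e<h t≡
  ...   | inj₂ (f , f< , e≡) = ascending f f< (trans t≡ (cong (toRight j +_) e≡))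

  data TopVPos (j t : ℕ) : Set where
    descending : t < toDown j → TopVPos j t
    edge       : ∀ e → e < vLen j → t ≡ toDown j + e → TopVPos j t

  topVPos : ∀ j t → t < topVLen j → TopVPos j t
  topVPos j t t< with <-+-split (toDown j) (vLen j) t t<
  ... | inj₁ t<d = descending t<d
  ... | inj₂ (e , e< , t≡) = edge e e< t≡

  descend-IsVtx : ∀ j k → 0 < a → j < b → IsVtx D (descend j k)
  descend-IsVtx j k 0<a j<b = (s≤s 0<a , j<b) , ≤-<-trans (m∸n≤m (rowLen j ∸ 1) k) (n∸1<n (rowLen-pos j 0<a j<b))

  embed-IsVtx : ∀ x → IsVtx D′ x → IsVtx D (embed x)
  embed-IsVtx (vx zero j , t) ((0<a , j<b) , _) = descend-IsVtx j 0 0<a j<b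
  embed-IsVtx (vx (suc x) j , t) ((x<a , j<b) , t<) = (s≤s x<a , j<b) , t<
  embed-IsVtx (eh zero j , t) ((0<a , sj<b) , t<) with topHPos j t t<
  ... | descending t<r = subst (IsVtx D) (sym (topH-descend j (suc t) t<r)) (descend-IsVtx j (suc t) 0<a (<-trans (n<1+n j) sj<b))
  ... | edge e e< refl = subst (IsVtx D) (sym (topH-edge j e e<)) ((s≤s 0<a , sj<b) , e<)
  ... | ascending f f< refl = subst (IsVtx D) (sym (topH-ascend j f)) ((s≤s 0<a , sj<b) ,
    ≤-<-trans (≤-trans (+-monoʳ-≤ (attach D 1 (suc j) left) (<⇒≤ f<)) (≤-reflexive (attach-left+toLeft (suc j))))
              (n∸1<n (rowLen-pos (suc j) 0<a sj<b)))
  embed-IsVtx (eh (suc x) j , t) ((x<a , j<b) , t<) = (s≤s x<a , j<b) , t<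
  embed-IsVtx (ev zero j , t) ((1<a , j<b) , t<) with topVPos j t t<
  ... | descending t<d = subst (IsVtx D) (sym (topV-descend j (suc t) t<d)) (descend-IsVtx j (suc t) (<-trans (s≤s z≤n) 1<a) j<b)
  ... | edge e e< refl = subst (IsVtx D) (sym (topV-edge j e e<)) ((s≤s 1<a , j<b) , e<)
  embed-IsVtx (ev (suc x) j , t) ((x<a , j<b) , t<) = (s≤s x<a , j<b) , t<

  descend-piece : ∀ j t dir → t < distFromQ (side₁ j dir) (rowLen j) →
    side₁ j dir ≡ pEnd × rowLen j ∸ 1 ∸ suc t ≢ rowLen j ∸ 1 × rowLen j ∸ 1 ∸ 1 ∸ (rowLen j ∸ 1 ∸ suc t) ≡ t
  descend-piece j t dir t< = at-p , below-top (rowLen j ∸ 1) st≤ , reread (rowLen j ∸ 1) st≤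
    where
    at-p = distFromQ-pos (side₁ j dir) (rowLen j) (≤-<-trans z≤n t<)
    st≤ : suc t ≤ rowLen j ∸ 1
    st≤ = subst (λ e → suc t ≤ distFromQ e (rowLen j)) at-p t<
    below-top : ∀ M → suc t ≤ M → M ∸ suc t ≢ M
    below-top (suc M) (s≤s t≤M) e = <-irrefl e (s≤s (m∸n≤m M t))
    reread : ∀ M → suc t ≤ M → M ∸ 1 ∸ (M ∸ suc t) ≡ t
    reread (suc M) (s≤s t≤M) = m∸[m∸n]≡n t≤M

  proj-embed : ∀ x → IsVtx D′ x → proj (embed x) ≡ x
  proj-embed (vx zero j , zero) _ = proj-top j
  proj-embed (vx zero j , suc t) (_ , s≤s ())
  proj-embed (vx (suc x) j , t) _ = refl
  proj-embed (eh zero j , t) ((0<a , sj<b) , t<) with topHPos j t t<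
  ... | descending t<r = let (at-p , ≢top , t≡) = descend-piece j t right t<r in
    trans (cong proj (topH-descend j (suc t) t<r))
      (trans (proj-piece j _ ≢top) (trans (cong (pieceOf j _) (right-at-p _ at-p)) (cong (eh 0 j ,_) t≡)))
  ... | edge e e< refl = cong proj (topH-edge j e e<)
  ... | ascending f f< refl = trans (cong proj (trans (topH-ascend j f) (cong (λ z → (vx 1 (suc j) , z + f)) attach≡0)))
                                (trans (proj-piece (suc j) f f≢top) (cong (pieceOf (suc j) f) (left-at-p _ at-p)))
    where
    at-p = distFromQ-pos (side₁ (suc j) left) (rowLen (suc j)) (≤-<-trans z≤n f<)
    attach≡0 : attach D 1 (suc j) left ≡ 0
    attach≡0 = trans (attach-endIndex D 1 (suc j) left) (cong (λ e → endIndex e (rowLen (suc j))) at-p)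
    f≢top : f ≢ rowLen (suc j) ∸ 1
    f≢top = <⇒≢ (subst (λ e → f < distFromQ e (rowLen (suc j))) at-p f<)
  proj-embed (eh (suc x) j , t) _ = refl
  proj-embed (ev zero j , t) ((1<a , j<b) , t<) with topVPos j t t<
  ... | descending t<d = let (at-p , ≢top , t≡) = descend-piece j t down t<d in
    trans (cong proj (topV-descend j (suc t) t<d))
      (trans (proj-piece j _ ≢top) (trans (cong (pieceOf j _) (down-at-p _ at-p)) (cong (ev 0 j ,_) t≡)))
  ... | edge e e< refl = cong proj (topV-edge j e e<)
  proj-embed (ev (suc x) j , t) _ = refl

  contains : Contains D D′
  contains = mkContains D D′ embed embed-IsVtx proj proj-embed vPath hWalk vWalk
    where
    vPath : ∀ x j t → IsObj a b (vx x j) → suc t < len D′ (vx x j) → Adj D (embed (vx x j , t)) (embed (vx x j , suc t))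
    vPath zero j t _ (s≤s ())
    vPath (suc x) j t (x<a , j<b) st< = inj₁ (inner (vx (suc (suc x)) j) t (s≤s x<a , j<b) st<)

  embed-Inset : ∀ x {t bo l ri} → IsVtx D′ x → Inset a b t bo l ri (proj₁ x) →
    Inset (suc a) b (suc t) bo l ri (proj₁ (embed x))
  embed-Inset (vx zero j , _) _ B = Inset-shift 1 (vx zero j) (vx 1 j) B ≤-refl ≤-refl ≤-refl ≤-refl
  embed-Inset (vx (suc x) j , _) _ B = Inset-shift 1 (vx (suc x) j) (vx (suc (suc x)) j) B ≤-refl ≤-refl ≤-refl ≤-refl
  embed-Inset (eh zero j , k) ((_ , _) , k<) B with topHPos j k k<
  ... | descending k<r rewrite topH-descend j (suc k) k<r = Inset-shift 1 (eh zero j) (vx 1 j) B ≤-refl ≤-refl ≤-refl (n≤1+n _)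
  ... | edge e e< refl rewrite topH-edge j e e< = Inset-shift 1 (eh zero j) (eh 1 j) B ≤-refl ≤-refl ≤-refl ≤-refl
  ... | ascending f f< refl rewrite topH-ascend j f = Inset-shift 1 (eh zero j) (vx 1 (suc j)) B ≤-refl ≤-refl (n≤1+n _) ≤-refl
  embed-Inset (eh (suc x) j , _) _ B = Inset-shift 1 (eh (suc x) j) (eh (suc (suc x)) j) B ≤-refl ≤-refl ≤-refl ≤-refl
  embed-Inset (ev zero j , k) ((_ , _) , k<) B with topVPos j k k<
  ... | descending k<d rewrite topV-descend j (suc k) k<d = Inset-shift 1 (ev zero j) (vx 1 j) B ≤-refl (n≤1+n _) ≤-refl ≤-refl
  ... | edge e e< refl rewrite topV-edge j e e< = Inset-shift 1 (ev zero j) (ev 1 j) B ≤-refl ≤-refl ≤-refl ≤-refl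
  embed-Inset (ev (suc x) j , _) _ B = Inset-shift 1 (ev (suc x) j) (ev (suc (suc x)) j) B ≤-refl ≤-refl ≤-refl ≤-refl

-- Deleting a column, and a row together with a column

module DeleteColumn {a b} (j₀ : ℕ) (D : PGData a (suc b)) (j₀+1<b : suc j₀ < b) where
  module T₁ = Transpose D
  module R = DeleteRow j₀ (transpose D) j₀+1<b
  module T₂ = Transpose R.D′

  D′ : PGData a b
  D′ = transpose R.D′

  contains : Contains D D′
  contains = Contains-trans (Contains-trans T₁.contains R.contains) T₂.contains

  shrinkObj : Obj → Obj
  shrinkObj μ = transposeObj (R.shrinkObj (transposeObj μ))

  embed-obj : ∀ x → proj₁ (ι contains x) ≡ transposeObj (proj₁ (R.embed (T₂.embed x)))
  embed-obj x = T₁.embed-obj (R.embed (T₂.embed x))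

  shrinkObj-embed : ∀ x → IsVtx D′ x → shrinkObj (proj₁ (ι contains x)) ≡ proj₁ x
  shrinkObj-embed x v = begin
    transposeObj (R.shrinkObj (transposeObj (proj₁ (ι contains x))))
      ≡⟨ cong (transposeObj ∘ R.shrinkObj ∘ transposeObj) (embed-obj x) ⟩
    transposeObj (R.shrinkObj (transposeObj (transposeObj (proj₁ (R.embed (T₂.embed x))))))
      ≡⟨ cong (transposeObj ∘ R.shrinkObj) (transposeObj-involutive (proj₁ (R.embed (T₂.embed x)))) ⟩
    transposeObj (R.shrinkObj (proj₁ (R.embed (T₂.embed x))))
      ≡⟨ cong transposeObj (R.shrinkObj-embed (T₂.embed x) (T₂.embed-IsVtx x v)) ⟩
    transposeObj (proj₁ (T₂.embed x))
      ≡⟨ cong transposeObj (T₂.embed-obj x) ⟩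
    transposeObj (transposeObj (proj₁ x))
      ≡⟨ transposeObj-involutive (proj₁ x) ⟩
    proj₁ x ∎
    where open ≡-Reasoning

  embed-avoids-column : ∀ x → IsVtx D′ x → ∀ i′ → proj₁ (ι contains x) ≢ ev i′ (suc j₀)
  embed-avoids-column x v i′ e = R.embed-avoids-row (T₂.embed x) (T₂.embed-IsVtx x v) i′
    (trans (sym (transposeObj-involutive _)) (cong transposeObj (trans (sym (embed-obj x)) e)))

  embed-Inset : ∀ x {t bo l ri} → IsVtx D′ x → Inset a b t bo l ri (proj₁ x) →
    Inset a (suc b) t bo l ri (proj₁ (ι contains x))
  embed-Inset x v B =
    T₁.embed-Inset (R.embed (T₂.embed x)) (R.embed-Inset (T₂.embed x) (T₂.embed-IsVtx x v) (T₂.embed-Inset x B))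

  shrinkObj-vx : ∀ i → shrinkObj (vx i (suc j₀)) ≡ eh i j₀
  shrinkObj-vx i = cong (transposeObj ∘ proj₁) (R.proj-row i 0)

  shrinkObj-eh : ∀ i → shrinkObj (eh i (suc j₀)) ≡ eh i j₀
  shrinkObj-eh i = cong (transposeObj ∘ proj₁) (R.proj-lower i 0)

module DeleteCross {a b} (i₀ j₀ : ℕ) (D : PGData (suc a) (suc b)) (i₀+1<a : suc i₀ < a) (j₀+1<b : suc j₀ < b) where
  module C = DeleteColumn j₀ D j₀+1<b
  module R = DeleteRow i₀ C.D′ i₀+1<a

  D′ : PGData a b
  D′ = R.D′

  contains : Contains D D′
  contains = Contains-trans C.contains R.contains

  shrinkObj : Obj → Obj
  shrinkObj = R.shrinkObj ∘ C.shrinkObj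

  shrinkObj-column : ∀ x → IsVtx D′ x → C.shrinkObj (proj₁ (ι contains x)) ≡ proj₁ (R.embed x)
  shrinkObj-column x v = C.shrinkObj-embed (R.embed x) (R.embed-IsVtx x v)

  shrinkObj-embed : ∀ x → IsVtx D′ x → shrinkObj (proj₁ (ι contains x)) ≡ proj₁ x
  shrinkObj-embed x v = trans (cong R.shrinkObj (shrinkObj-column x v)) (R.shrinkObj-embed x v)

  embed-Inset : ∀ x {t bo l ri} → IsVtx D′ x → Inset a b t bo l ri (proj₁ x) →
    Inset (suc a) (suc b) t bo l ri (proj₁ (ι contains x))
  embed-Inset x v B = C.embed-Inset (R.embed x) (R.embed-IsVtx x v) (R.embed-Inset x v B)

  -- Deleting the column turns vx and eh at (i₀+1, j₀+1) into parts of eh (i₀+1) j₀, which lies in the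
  -- deleted row; ev (i₀+1) (j₀+1) lies in the deleted column.
  embed-avoids : ∀ x → IsVtx D′ x → ∀ μ → rowMin μ ≡ suc i₀ → colMin μ ≡ suc j₀ → proj₁ (ι contains x) ≢ μ
  embed-avoids x v (vx _ _) refl refl e =
    R.embed-avoids-row x v j₀ (trans (sym (shrinkObj-column x v)) (trans (cong C.shrinkObj e) (C.shrinkObj-vx (suc i₀))))
  embed-avoids x v (eh _ _) refl refl e =
    R.embed-avoids-row x v j₀ (trans (sym (shrinkObj-column x v)) (trans (cong C.shrinkObj e) (C.shrinkObj-eh (suc i₀))))
  embed-avoids x v (ev _ _) refl refl = C.embed-avoids-column (R.embed x) (R.embed-IsVtx x v) (suc i₀)

-- Peeling off the outer layer

module PeelTopBottom {a b} (D : PGData (suc (suc (suc a))) b) where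
  module P₁ = PeelTop D
  module F₁ = Flip P₁.D′
  module P₂ = PeelTop F₁.D′
  module F₂ = Flip P₂.D′

  D′ : PGData (suc a) b
  D′ = F₂.D′

  contains : Contains D D′
  contains = Contains-trans P₁.contains (Contains-trans F₁.contains (Contains-trans P₂.contains F₂.contains))

  embed-Inset : ∀ x {t bo l ri} → IsVtx D′ x → Inset (suc a) b t bo l ri (proj₁ x) →
    Inset (suc (suc (suc a))) b (suc t) (suc bo) l ri (proj₁ (ι contains x))
  embed-Inset x v B =
    P₁.embed-Inset x₁ v₁ (F₁.embed-Inset x₂ v₂ (P₂.embed-Inset x₃ v₃ (F₂.embed-Inset x v B)))
    where
    x₃ = F₂.embed x
    v₃ = F₂.embed-IsVtx x v
    x₂ = P₂.embed x₃
    v₂ = P₂.embed-IsVtx x₃ v₃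
    x₁ = F₁.embed x₂
    v₁ = F₁.embed-IsVtx x₂ v₂

module PeelAll {a b} (D : PGData (suc (suc (suc a))) (suc (suc (suc b)))) where
  module B₁ = PeelTopBottom D
  module T₁ = Transpose B₁.D′
  module B₂ = PeelTopBottom (transpose B₁.D′)
  module T₂ = Transpose B₂.D′

  D′ : PGData (suc a) (suc b)
  D′ = transpose B₂.D′

  contains : Contains D D′
  contains = Contains-trans B₁.contains (Contains-trans T₁.contains (Contains-trans B₂.contains T₂.contains))

  embed-Inset : ∀ x {t bo l ri} → IsVtx D′ x → Inset (suc a) (suc b) t bo l ri (proj₁ x) →
    Inset (suc (suc (suc a))) (suc (suc (suc b))) (suc t) (suc bo) (suc l) (suc ri) (proj₁ (ι contains x))
  embed-Inset x v B =
    B₁.embed-Inset x₁ v₁ (T₁.embed-Inset x₂ (B₂.embed-Inset x₃ v₃ (T₂.embed-Inset x B)))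
    where
    x₃ = T₂.embed x
    v₃ = T₂.embed-IsVtx x v
    x₂ = ι B₂.contains x₃
    v₂ = ι-IsVtx B₂.contains x₃ v₃
    x₁ = T₁.embed x₂
    v₁ = T₁.embed-IsVtx x₂ v₂

InInt⇒Inset : ∀ {a b r} μ → InInt a b r μ → Inset a b r r r r μ
InInt⇒Inset (vx i j) ((p , q) , (u , v)) = p , q , u , v
InInt⇒Inset (eh i j) ((p , q) , (u , v) , (u′ , v′)) = p , q , u , v′
InInt⇒Inset (ev i j) ((p , q) , (p′ , q′) , (u , v)) = p , q′ , u , v

Inset⇒InInt : ∀ {a b r} μ → Inset a b r r r r μ → InInt a b r μ
Inset⇒InInt (vx i j) (p , q , u , v) = (p , q) , (u , v)
Inset⇒InInt {r = r} (eh i j) (p , q , u , v) = (p , q) , (u , <-trans (+-monoˡ-< r (n<1+n j)) v) , (m≤n⇒m≤1+n u , v)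
Inset⇒InInt {r = r} (ev i j) (p , q , u , v) = (p , <-trans (+-monoˡ-< r (n<1+n i)) q) , (m≤n⇒m≤1+n p , q) , (u , v)

m+n<o⇒m<o : ∀ m {n o} → m + n < o → m < o
m+n<o⇒m<o m = m+n≤o⇒m≤o (suc m)

InInt⇒IsObj : ∀ {a b r} μ → InInt a b r μ → IsObj a b μ
InInt⇒IsObj (vx i j) ((_ , p) , (_ , q)) = m+n<o⇒m<o i p , m+n<o⇒m<o j q
InInt⇒IsObj (eh i j) ((_ , p) , _ , (_ , q)) = m+n<o⇒m<o i p , m+n<o⇒m<o (suc j) q
InInt⇒IsObj (ev i j) (_ , (_ , p) , (_ , q)) = m+n<o⇒m<o (suc i) p , m+n<o⇒m<o j q

<⇒+0< : ∀ {m n} → m < n → m + 0 < n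
<⇒+0< {m} = subst (_< _) (sym (+-identityʳ m))

IsObj⇒InInt₀ : ∀ {a b} μ → IsObj a b μ → InInt a b 0 μ
IsObj⇒InInt₀ (vx i j) (p , q) = (z≤n , <⇒+0< p) , (z≤n , <⇒+0< q)
IsObj⇒InInt₀ (eh i j) (p , q) = (z≤n , <⇒+0< p) , (z≤n , <⇒+0< (<-trans (n<1+n j) q)) , (z≤n , <⇒+0< q)
IsObj⇒InInt₀ (ev i j) (p , q) = (z≤n , <⇒+0< (<-trans (n<1+n i) p)) , (z≤n , <⇒+0< p) , (z≤n , <⇒+0< q)

InRange? : ∀ n r i → Dec (InRange n r i)
InRange? n r i = (r ≤? i) ×-dec (i + r <? n)

InInt? : ∀ a b r μ → Dec (InInt a b r μ)
InInt? a b r (vx i j) = InRange? a r i ×-dec InRange? b r j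
InInt? a b r (eh i j) = InRange? a r i ×-dec (InRange? b r j ×-dec InRange? b r (suc j))
InInt? a b r (ev i j) = InRange? a r i ×-dec (InRange? a r (suc i) ×-dec InRange? b r j)

InInt⇒InRange : ∀ {a b r} μ → InInt a b r μ → InRange a r (rowMin μ) × InRange b r (colMin μ)
InInt⇒InRange (vx i j) (p , q) = p , q
InInt⇒InRange (eh i j) (p , q , _) = p , q
InInt⇒InRange (ev i j) (p , _ , q) = p , q

Hits? : ∀ {a b} (D : PGData a b) ψ A μ → Dec (Hits D ψ A μ)
Hits? D ψ A μ = anyUpTo? (λ t → ψ (μ , t) ∈? A) (len D μ)

Covers : ∀ {k} → PGData k k → (PVtx → ℕ) → List ℕ → ℕ → List Obj → Set
Covers {k} D ψ A r L = ∀ μ → InInt k k r μ → Hits D ψ A μ → μ ∈ L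

Avoids : ∀ {k} → PGData k k → (PVtx → ℕ) → List ℕ → Set
Avoids D ψ A = ∀ x → IsVtx D x → ψ x ∉ A

record Shrinking {k} (D : PGData k k) (m : ℕ) (P : ∀ {k′} → PGData k′ k′ → (PVtx → PVtx) → Set) : Set where
  constructor shrinking
  field
    {k′}     : ℕ
    D′       : PGData k′ k′
    contains : Contains D D′
    k≤k′+m   : k ≤ k′ + m
    property : P D′ (ι contains)

Shrinking-refl : ∀ {k} {P : ∀ {k′} → PGData k′ k′ → (PVtx → PVtx) → Set} (D : PGData k k) →
  P D (λ x → x) → Shrinking D 0 P
Shrinking-refl {k} D p = shrinking D (Contains-refl D) (≤-reflexive (sym (+-identityʳ k))) p

Shrinking-∘ : ∀ {k k₁ m₁ m₂} {D : PGData k k} {D₁ : PGData k₁ k₁} (P : ∀ {k′} → PGData k′ k′ → (PVtx → PVtx) → Set)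
  (E : Contains D D₁) → k ≤ k₁ + m₁ → Shrinking D₁ m₂ (λ D′ ι′ → P D′ (ι E ∘ ι′)) → Shrinking D (m₁ + m₂) P
Shrinking-∘ {k₁ = k₁} {m₁} {m₂} P E k≤ (shrinking {k′} D′ E′ k₁≤ p) = shrinking D′ (Contains-trans E E′) bound p
  where
  open ≤-Reasoning
  bound = begin
    _              ≤⟨ k≤ ⟩
    k₁ + m₁        ≤⟨ +-monoˡ-≤ m₁ k₁≤ ⟩
    k′ + m₂ + m₁   ≡⟨ +-assoc k′ m₂ m₁ ⟩
    k′ + (m₂ + m₁) ≡⟨ cong (k′ +_) (+-comm m₂ m₁) ⟩
    k′ + (m₁ + m₂) ∎

Shrinking-weaken : ∀ {k m m′} {D : PGData k k} {P : ∀ {k′} → PGData k′ k′ → (PVtx → PVtx) → Set} →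
  m ≤ m′ → Shrinking D m P → Shrinking D m′ P
Shrinking-weaken m≤m′ (shrinking D′ E k≤ p) = shrinking D′ E (≤-trans k≤ (+-monoʳ-≤ _ m≤m′)) p

record CrossDeletion {k} (D : PGData k k) (μ : Obj) : Set where
  field
    {k₁}            : ℕ
    D₁              : PGData k₁ k₁
    contains        : Contains D D₁
    k≡1+k₁          : k ≡ suc k₁
    shrinkObj       : Obj → Obj
    shrinkObj-embed : ∀ x → IsVtx D₁ x → shrinkObj (proj₁ (ι contains x)) ≡ proj₁ x
    embed-Inset     : ∀ x {t bo l ri} → IsVtx D₁ x → Inset k₁ k₁ t bo l ri (proj₁ x) →
                      Inset k k t bo l ri (proj₁ (ι contains x))
    embed-avoids    : ∀ x → IsVtx D₁ x → proj₁ (ι contains x) ≢ μ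

deleteCross : ∀ {k} (D : PGData k k) μ → 1 ≤ rowMin μ → 1 ≤ colMin μ → suc (rowMin μ) < k → suc (colMin μ) < k →
  CrossDeletion D μ
deleteCross {suc k₁} D μ i≥1 j≥1 i+1<k j+1<k with rowMin μ in i≡ | colMin μ in j≡
deleteCross {suc k₁} D μ (s≤s z≤n) (s≤s z≤n) (s≤s i₀+1<k₁) (s≤s j₀+1<k₁) | suc i₀ | suc j₀ = record
  { D₁ = X.D′ ; contains = X.contains ; k≡1+k₁ = refl ; shrinkObj = X.shrinkObj ; shrinkObj-embed = X.shrinkObj-embed
  ; embed-Inset = X.embed-Inset ; embed-avoids = λ x v → X.embed-avoids x v μ i≡ j≡ }
  where
  module X = DeleteCross i₀ j₀ D i₀+1<k₁ j₀+1<k₁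

InRange⇒inner : ∀ {k r i} → 1 ≤ r → InRange k r i → 1 ≤ i × suc i < k
InRange⇒inner {k} {r} {i} r≥1 (r≤i , i+r<k) = ≤-trans r≥1 r≤i , ≤-<-trans (≤-trans (≤-reflexive (+-comm 1 i)) (+-monoʳ-≤ i r≥1)) i+r<k

NoInteriorHits : ∀ {k′} → ℕ → (PVtx → ℕ) → List ℕ → PGData k′ k′ → (PVtx → PVtx) → Set
NoInteriorHits r ψ A D′ ι = Covers D′ (ψ ∘ ι) A r []

-- Each deleted cross removes one listed object and shrinks the grid by one; the other listed objects are
-- followed into the smaller grid by shrinkObj.
deleteCrosses : ∀ r → 1 ≤ r → ∀ n (L : List Obj) → length L ≤ n → ∀ {k} (D : PGData k k) ψ A →
  Covers D ψ A r L → Shrinking D (length L) (NoInteriorHits r ψ A)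
deleteCrosses r r≥1 n [] _ D ψ A cov = Shrinking-refl D cov
deleteCrosses r r≥1 (suc n) (μ ∷ L) (s≤s L≤n) {k} D ψ A cov with InInt? k k r μ
... | no μ∉int = Shrinking-weaken (n≤1+n (length L)) (deleteCrosses r r≥1 n L L≤n D ψ A tail-covers)
  where
  tail-covers : Covers D ψ A r L
  tail-covers μ′ int hit with cov μ′ int hit
  ... | here refl = ⊥-elim (μ∉int int)
  ... | there μ′∈L = μ′∈L
... | yes μ∈int = Shrinking-∘ (NoInteriorHits r ψ A) X.contains (≤-reflexive (trans X.k≡1+k₁ (+-comm 1 X.k₁)))
      (subst (λ m → Shrinking X.D₁ m (NoInteriorHits r (ψ ∘ ι X.contains) A)) (length-map X.shrinkObj L)
        (deleteCrosses r r≥1 n (map X.shrinkObj L) (≤-trans (≤-reflexive (length-map X.shrinkObj L)) L≤n)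
          X.D₁ (ψ ∘ ι X.contains) A covers₁))
  where
  rows = InInt⇒InRange μ μ∈int
  X : CrossDeletion D μ
  X = deleteCross D μ (proj₁ (InRange⇒inner r≥1 (proj₁ rows))) (proj₁ (InRange⇒inner r≥1 (proj₂ rows)))
                      (proj₂ (InRange⇒inner r≥1 (proj₁ rows))) (proj₂ (InRange⇒inner r≥1 (proj₂ rows)))
  module X = CrossDeletion X
  covers₁ : Covers X.D₁ (ψ ∘ ι X.contains) A r (map X.shrinkObj L)
  covers₁ μ′ int′ (t , t< , c∈A) with cov o o-int (proj₂ (ι X.contains x) , proj₂ (ι-IsVtx X.contains x v) , c∈A)
    where
    x = (μ′ , t)
    v : IsVtx X.D₁ x
    v = InInt⇒IsObj μ′ int′ , t<
    o = proj₁ (ι X.contains x)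
    o-int : InInt k k r o
    o-int = Inset⇒InInt o (X.embed-Inset x v (InInt⇒Inset μ′ int′))
  ... | here o≡μ = ⊥-elim (X.embed-avoids (μ′ , t) (InInt⇒IsObj μ′ int′ , t<) o≡μ)
  ... | there o∈L =
    subst (_∈ map X.shrinkObj L) (X.shrinkObj-embed (μ′ , t) (InInt⇒IsObj μ′ int′ , t<)) (∈-map⁺ X.shrinkObj o∈L)

empty : PGData 0 0
empty = record { len = λ _ → 1 ; qtype = λ _ _ → Q1 ; len-vx = λ i j () ; len-deg = λ i j () }

¬IsObj-empty : ∀ {b} μ → ¬ IsObj 0 b μ
¬IsObj-empty (vx i j) (() , _)
¬IsObj-empty (eh i j) (() , _)
¬IsObj-empty (ev i j) (() , _)

shrinkToEmpty : ∀ {k m} (D : PGData k k) {P : ∀ {k′} → PGData k′ k′ → (PVtx → PVtx) → Set} →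
  k ≤ m → (∀ ι → P empty ι) → Shrinking D m P
shrinkToEmpty D k≤m p = shrinking empty contains k≤m (p (λ x → x))
  where
  contains : Contains D empty
  contains = record
    { ι = λ x → x
    ; ι-IsVtx = λ x v → ⊥-elim (¬IsObj-empty (proj₁ x) (proj₁ v))
    ; ι-injective = λ x y v _ _ → ⊥-elim (¬IsObj-empty (proj₁ x) (proj₁ v))
    ; ι-Adj = λ x y v _ _ → ⊥-elim (¬IsObj-empty (proj₁ x) (proj₁ v)) }

AvoidsColours : (PVtx → ℕ) → List ℕ → ∀ {k′} → PGData k′ k′ → (PVtx → PVtx) → Set
AvoidsColours ψ A D′ ι = Avoids D′ (ψ ∘ ι) A

Avoids-empty : ∀ ψ A ι → AvoidsColours ψ A empty ι
Avoids-empty ψ A ι x v = ⊥-elim (¬IsObj-empty (proj₁ x) (proj₁ v))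

2≤2*[1+r] : ∀ r → 2 ≤ 2 * suc r
2≤2*[1+r] r = *-monoʳ-≤ 2 (s≤s (z≤n {r}))

peelLayers : ∀ r {k} (D : PGData k k) ψ A → Covers D ψ A r [] → Shrinking D (2 * r) (AvoidsColours ψ A)
peelLayers zero D ψ A cov =
  Shrinking-refl D (λ x v c∈A → ∉[] (cov (proj₁ x) (IsObj⇒InInt₀ (proj₁ x) (proj₁ v)) (proj₂ x , proj₂ v , c∈A)))
peelLayers (suc r) {0} D ψ A cov = shrinkToEmpty D z≤n (Avoids-empty ψ A)
peelLayers (suc r) {1} D ψ A cov = shrinkToEmpty D (≤-trans (s≤s z≤n) (2≤2*[1+r] r)) (Avoids-empty ψ A)
peelLayers (suc r) {2} D ψ A cov = shrinkToEmpty D (2≤2*[1+r] r) (Avoids-empty ψ A)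
peelLayers (suc r) {suc (suc (suc k₀))} D ψ A cov =
  subst (λ m → Shrinking D m (AvoidsColours ψ A)) (sym (*-suc 2 r))
    (Shrinking-∘ (AvoidsColours ψ A) P.contains (≤-reflexive (sym (+-comm (suc k₀) 2)))
      (peelLayers r P.D′ (ψ ∘ ι P.contains) A cov′))
  where
  module P = PeelAll D
  cov′ : Covers P.D′ (ψ ∘ ι P.contains) A r []
  cov′ μ′ int′ (t , t< , c∈A) =
    ⊥-elim (∉[] (cov (proj₁ (ι P.contains x)) int (proj₂ (ι P.contains x) , proj₂ (ι-IsVtx P.contains x v) , c∈A)))
    where
    x = (μ′ , t)
    v : IsVtx P.D′ x
    v = InInt⇒IsObj μ′ int′ , t<
    int = Inset⇒InInt (proj₁ (ι P.contains x)) (P.embed-Inset x v (InInt⇒Inset μ′ int′))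

removeColours : ∀ r → 1 ≤ r → ∀ {k} (D : PGData k k) ψ A (L : List Obj) → Covers D ψ A r L →
  Shrinking D (length L + 2 * r) (AvoidsColours ψ A)
removeColours r r≥1 D ψ A L cov with deleteCrosses r r≥1 (length L) L ≤-refl D ψ A cov
... | shrinking D₁ E₁ k≤ cov₁ = Shrinking-∘ (AvoidsColours ψ A) E₁ k≤ (peelLayers r D₁ (ψ ∘ ι E₁) A cov₁)

_≟Obj_ : DecidableEquality Obj
vx i j ≟Obj vx i′ j′ = map′ (λ (p , q) → cong₂ vx p q) (λ { refl → refl , refl }) (i ≟ i′ ×-dec j ≟ j′)
eh i j ≟Obj eh i′ j′ = map′ (λ (p , q) → cong₂ eh p q) (λ { refl → refl , refl }) (i ≟ i′ ×-dec j ≟ j′)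
ev i j ≟Obj ev i′ j′ = map′ (λ (p , q) → cong₂ ev p q) (λ { refl → refl , refl }) (i ≟ i′ ×-dec j ≟ j′)
vx _ _ ≟Obj eh _ _ = no λ ()
vx _ _ ≟Obj ev _ _ = no λ ()
eh _ _ ≟Obj vx _ _ = no λ ()
eh _ _ ≟Obj ev _ _ = no λ ()
ev _ _ ≟Obj vx _ _ = no λ ()
ev _ _ ≟Obj eh _ _ = no λ ()

rowObjs : ℕ → ℕ → List Obj
rowObjs i zero = []
rowObjs i (suc j) = vx i j ∷ eh i j ∷ ev i j ∷ rowObjs i j

gridObjs : ℕ → ℕ → List Obj
gridObjs zero n = []
gridObjs (suc i) n = rowObjs i n ++ gridObjs i n

∈-rowObjs : ∀ μ n → colMin μ < n → μ ∈ rowObjs (rowMin μ) n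
∈-rowObjs μ (suc n) j<1+n with colMin μ ≟ n
∈-rowObjs (vx i j) (suc n) _ | yes refl = here refl
∈-rowObjs (eh i j) (suc n) _ | yes refl = there (here refl)
∈-rowObjs (ev i j) (suc n) _ | yes refl = there (there (here refl))
... | no j≢n = there (there (there (∈-rowObjs μ n (≤∧≢⇒< (≤-pred j<1+n) j≢n))))

∈-gridObjs : ∀ μ m n → rowMin μ < m → colMin μ < n → μ ∈ gridObjs m n
∈-gridObjs μ (suc m) n i<1+m j<n with rowMin μ ≟ m
... | yes i≡m = ∈-++⁺ˡ (subst (λ z → μ ∈ rowObjs z n) i≡m (∈-rowObjs μ n j<n))
... | no i≢m = ∈-++⁺ʳ (rowObjs m n) (∈-gridObjs μ m n (≤∧≢⇒< (≤-pred i<1+m) i≢m) j<n)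

interiorHits : ∀ {k} (D : PGData k k) (ψ : PVtx → ℕ) (A : List ℕ) r → List Obj
interiorHits {k} D ψ A r = deduplicate _≟Obj_ (filter (λ μ → InInt? k k r μ ×-dec Hits? D ψ A μ) (gridObjs k k))

∈-interiorHits⁻ : ∀ {k} (D : PGData k k) ψ A r μ → μ ∈ interiorHits D ψ A r → InInt k k r μ × Hits D ψ A μ
∈-interiorHits⁻ {k} D ψ A r μ μ∈ =
  proj₂ (∈-filter⁻ (λ μ → InInt? k k r μ ×-dec Hits? D ψ A μ) {xs = gridObjs k k} (∈-deduplicate⁻ _≟Obj_ _ μ∈))

∈-interiorHits⁺ : ∀ {k} (D : PGData k k) ψ A r → Covers D ψ A r (interiorHits D ψ A r)
∈-interiorHits⁺ {k} D ψ A r μ int hit =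
  ∈-deduplicate⁺ _≟Obj_ (∈-filter⁺ (λ μ → InInt? k k r μ ×-dec Hits? D ψ A μ)
    (∈-gridObjs μ k k (m+n<o⇒m<o _ (proj₂ i-range)) (m+n<o⇒m<o _ (proj₂ j-range))) (int , hit))
  where
  i-range = proj₁ (InInt⇒InRange μ int)
  j-range = proj₂ (InInt⇒InRange μ int)

bipartitions : List ℕ → List (List ℕ × List ℕ)
bipartitions [] = ([] , []) ∷ []
bipartitions (x ∷ xs) = map (map₁ (x ∷_)) (bipartitions xs) ++ map (map₂ (x ∷_)) (bipartitions xs)

bipartitions-length : ∀ U {S C} → (S , C) ∈ bipartitions U → length S + length C ≡ length U
bipartitions-length [] (here refl) = refl
bipartitions-length (x ∷ xs) {S} {C} p∈ with ∈-++⁻ (map (map₁ (x ∷_)) (bipartitions xs)) p∈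
... | inj₁ p∈₁ with ∈-map⁻ (map₁ (x ∷_)) p∈₁
...   | (S′ , C′) , q∈ , refl = cong suc (bipartitions-length xs q∈)
bipartitions-length (x ∷ xs) {S} {C} p∈ | inj₂ p∈₂ with ∈-map⁻ (map₂ (x ∷_)) p∈₂
...   | (S′ , C′) , q∈ , refl = trans (+-suc (length S′) (length C′)) (cong suc (bipartitions-length xs q∈))

bipartitions-cover : ∀ U {S C c} → (S , C) ∈ bipartitions U → c ∈ U → c ∈ S ⊎ c ∈ C
bipartitions-cover (x ∷ xs) p∈ c∈ with ∈-++⁻ (map (map₁ (x ∷_)) (bipartitions xs)) p∈
... | inj₁ p∈₁ with ∈-map⁻ (map₁ (x ∷_)) p∈₁
...   | (S′ , C′) , q∈ , refl with c∈
...     | here c≡x = inj₁ (here c≡x)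
...     | there c∈xs = Data.Sum.map₁ there (bipartitions-cover xs q∈ c∈xs)
bipartitions-cover (x ∷ xs) p∈ c∈ | inj₂ p∈₂ with ∈-map⁻ (map₂ (x ∷_)) p∈₂
...   | (S′ , C′) , q∈ , refl with c∈
...     | here c≡x = inj₂ (here c≡x)
...     | there c∈xs = Data.Sum.map₂ there (bipartitions-cover xs q∈ c∈xs)

filter-∈-bipartitions : ∀ (A : List ℕ) U → (filter (_∈? A) U , filter (¬? ∘ (_∈? A)) U) ∈ bipartitions U
filter-∈-bipartitions A [] = here refl
filter-∈-bipartitions A (x ∷ xs) with x ∈? A
... | yes _ = ∈-++⁺ˡ (∈-map⁺ (map₁ (x ∷_)) (filter-∈-bipartitions A xs))
... | no _ = ∈-++⁺ʳ (map (map₁ (x ∷_)) (bipartitions xs)) (∈-map⁺ (map₂ (x ∷_)) (filter-∈-bipartitions A xs))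

Unique⇒length≤ : ∀ (xs ys : List ℕ) → Unique xs → (∀ {z} → z ∈ xs → z ∈ ys) → length xs ≤ length ys
Unique⇒length≤ [] ys _ _ = z≤n
Unique⇒length≤ (x ∷ xs) ys (x∉xs AllPairs.∷ u) xs⊆ys with ∈-∃++ (xs⊆ys (here refl))
... | ys₁ , ys₂ , refl = ≤-trans (s≤s (Unique⇒length≤ xs (ys₁ ++ ys₂) u xs⊆ys₁++ys₂)) (≤-reflexive (sym length-split))
  where
  xs⊆ys₁++ys₂ : ∀ {z} → z ∈ xs → z ∈ ys₁ ++ ys₂
  xs⊆ys₁++ys₂ z∈ with ∈-++⁻ ys₁ (xs⊆ys (there z∈))
  ... | inj₁ z∈₁ = ∈-++⁺ˡ z∈₁
  ... | inj₂ (here refl) = ⊥-elim (All-lookup x∉xs z∈ refl)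
  ... | inj₂ (there z∈₂) = ∈-++⁺ʳ ys₁ z∈₂
  length-split : length (ys₁ ++ x ∷ ys₂) ≡ suc (length (ys₁ ++ ys₂))
  length-split = trans (length-++ ys₁) (trans (+-suc (length ys₁) (length ys₂)) (cong suc (sym (length-++ ys₁))))

-- Removing s ≥ 1 colours at a cost of fewer than d s + 2 r ≤ (d + 2 r) s rows and columns keeps the budget.
budget-step : ∀ {k k₁ k₂ d r s c cs l} → 1 ≤ s → l < d * s →
  k + (d + 2 * r) * (s + c) ≤ k₁ + (d + 2 * r) * cs → k₁ ≤ k₂ + (l + 2 * r) →
  k + (d + 2 * r) * c ≤ k₂ + (d + 2 * r) * cs
budget-step {k} {k₁} {k₂} {d} {r} {s} {c} {cs} {l} s≥1 l<ds before k₁≤ = +-cancelʳ-≤ (M * s) (k + M * c) (k₂ + M * cs) (begin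
  k + M * c + M * s   ≡⟨ +-assoc k (M * c) (M * s) ⟩
  k + (M * c + M * s) ≡⟨ cong (k +_) (trans (+-comm (M * c) (M * s)) (sym (*-distribˡ-+ M s c))) ⟩
  k + M * (s + c)     ≤⟨ before ⟩
  k₁ + M * cs         ≤⟨ +-monoˡ-≤ (M * cs) (≤-trans k₁≤ (+-monoʳ-≤ k₂ cost≤)) ⟩
  k₂ + M * s + M * cs ≡⟨ +-assoc k₂ (M * s) (M * cs) ⟩
  k₂ + (M * s + M * cs) ≡⟨ cong (k₂ +_) (+-comm (M * s) (M * cs)) ⟩
  k₂ + (M * cs + M * s) ≡⟨ sym (+-assoc k₂ (M * cs) (M * s)) ⟩
  k₂ + M * cs + M * s ∎)
  where
  open ≤-Reasoning
  M = d + 2 * r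
  cost≤ : l + 2 * r ≤ M * s
  cost≤ = ≤-trans (+-mono-≤ (<⇒≤ l<ds) (≤-trans (≤-reflexive (sym (*-identityʳ (2 * r)))) (*-monoʳ-≤ (2 * r) s≥1)))
                  (≤-reflexive (sym (*-distribʳ-+ s d (2 * r))))

module Iteration (d r : ℕ) (r≥1 : 1 ≤ r) {k} (D : PGData k k) (φ : PVtx → ℕ) (Cs : List ℕ) where
  M : ℕ
  M = d + 2 * r

  Conclusion : Set
  Conclusion = ∃ λ (k′ : ℕ) → Σ (PGData k′ k′) λ D′ → Σ (PVtx → PVtx) λ ι →
    (∀ x → IsVtx D′ x → IsVtx D (ι x)) ×
    (∀ x y → IsVtx D′ x → IsVtx D′ y → ι x ≡ ι y → x ≡ y) ×
    (∀ x y → IsVtx D′ x → IsVtx D′ y → Adj D′ x y → Adj D (ι x) (ι y)) ×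
    k ≤ k′ + (d + 2 * r) * length Cs ×
    ((A : List ℕ) → Unique A → All (Used D′ (φ ∘ ι)) A →
      ∃ λ (Ms : List Obj) → Unique Ms × d * length A ≤ length Ms ×
        All (λ μ → InInt k′ k′ r μ × Hits D′ (φ ∘ ι) A μ) Ms)

  -- U lists the colours that may still occur; each of them has been paid for in advance.
  record Stage : Set where
    constructor stage
    field
      {k′}      : ℕ
      D′        : PGData k′ k′
      contains  : Contains D D′
      U         : List ℕ
      colours⊆U : ∀ c → Used D′ (φ ∘ ι contains) c → c ∈ U
      budget    : k + M * length U ≤ k′ + M * length Cs

    ψ : PVtx → ℕ
    ψ = φ ∘ ι contains

    Good : List ℕ × List ℕ → Set
    Good (S , _) = d * length S ≤ length (interiorHits D′ ψ S r)

    Good? : ∀ p → Dec (Good p)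
    Good? (S , _) = d * length S ≤? length (interiorHits D′ ψ S r)

  finish : (st : Stage) → All (Stage.Good st) (bipartitions (Stage.U st)) → Conclusion
  finish (stage D′ E U colours⊆U budget) good =
    _ , D′ , ι E , ι-IsVtx E , ι-injective E , ι-Adj E , ≤-trans (m≤m+n k _) budget , hits
    where
    ψ = φ ∘ ι E
    hits : (A : List ℕ) → Unique A → All (Used D′ ψ) A → _
    hits A A-unique A-used = interiorHits D′ ψ S r , UniqueDec.deduplicate-! _≟Obj_ _ , ≤-trans (*-monoʳ-≤ d |A|≤|S|) S-good ,
                             tabulate (λ {μ} μ∈ → let (int , (t , t< , c∈S)) = ∈-interiorHits⁻ D′ ψ S r μ μ∈ in
                                         int , (t , t< , proj₂ (∈-filter⁻ (_∈? A) {xs = U} c∈S)))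
      where
      S = filter (_∈? A) U
      S-good = All-lookup good (filter-∈-bipartitions A U)
      |A|≤|S| : length A ≤ length S
      |A|≤|S| = Unique⇒length≤ A S A-unique (λ c∈A → ∈-filter⁺ (_∈? A) (colours⊆U _ (All-lookup A-used c∈A)) c∈A)

  -- A violating part S is removed entirely, at a cost the budget for S covers.
  refine : (st : Stage) → ∀ {S C} → (S , C) ∈ bipartitions (Stage.U st) → ¬ Stage.Good st (S , C) →
    Σ Stage λ st′ → length (Stage.U st′) < length (Stage.U st)
  refine (stage D′ E U colours⊆U budget) {S} {C} p∈ bad =
    stage D″ (Contains-trans E E′) C colours⊆C
      (budget-step {d = d} {r = r} 1≤|S| few (subst (λ u → k + M * u ≤ _) (sym split) budget) k′≤) ,
    subst (length C <_) split (≤-trans (+-monoˡ-≤ (length C) 1≤|S|) ≤-refl)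
    where
    ψ = φ ∘ ι E
    L = interiorHits D′ ψ S r
    few : length L < d * length S
    few = ≰⇒> bad
    split = bipartitions-length U p∈
    1≤|S| : 1 ≤ length S
    1≤|S| = n≢0⇒n>0 λ |S|≡0 → n≮0 (subst (length L <_) (trans (cong (d *_) |S|≡0) (*-zeroʳ d)) few)
    R = removeColours r r≥1 D′ ψ S L (∈-interiorHits⁺ D′ ψ S r)
    open Shrinking R renaming (D′ to D″; contains to E′; k≤k′+m to k′≤; property to avoids)
    colours⊆C : ∀ c → Used D″ (ψ ∘ ι E′) c → c ∈ C
    colours⊆C c (x , v , ψx≡c) with bipartitions-cover U p∈ (colours⊆U c (ι E′ x , ι-IsVtx E′ x v , ψx≡c))
    ... | inj₁ c∈S = ⊥-elim (avoids x v (subst (_∈ S) (sym ψx≡c) c∈S))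
    ... | inj₂ c∈C = c∈C

  iterate : ∀ n (st : Stage) → length (Stage.U st) ≤ n → Conclusion
  iterate n st |U|≤n with all? (Stage.Good? st) (bipartitions (Stage.U st))
  ... | yes good = finish st good
  ... | no ¬good with find (¬All⇒Any¬ (Stage.Good? st) _ ¬good)
  ...   | (S , C) , p∈ , bad with refine st p∈ bad | n
  ...     | st′ , shorter | zero = ⊥-elim (n≮0 (≤-trans shorter |U|≤n))
  ...     | st′ , shorter | suc n′ = iterate n′ st′ (≤-pred (≤-trans shorter |U|≤n))

lemma8 : (d k r : ℕ) → 1 ≤ d → 1 ≤ k → 1 ≤ r →
    (D : PGData k k) → (φ : PVtx → ℕ) →
    (Cs : List ℕ) → Unique Cs → (∀ c → (c ∈ Cs) ⇔ Used D φ c) →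
    (d + 2 * r) * length Cs ≤ k →
    ∃ λ (k′ : ℕ) → Σ (PGData k′ k′) λ D′ → Σ (PVtx → PVtx) λ ι →
      (∀ x → IsVtx D′ x → IsVtx D (ι x)) ×
      (∀ x y → IsVtx D′ x → IsVtx D′ y → ι x ≡ ι y → x ≡ y) ×
      (∀ x y → IsVtx D′ x → IsVtx D′ y → Adj D′ x y → Adj D (ι x) (ι y)) ×
      k ≤ k′ + (d + 2 * r) * length Cs ×
      ((A : List ℕ) → Unique A → All (Used D′ (φ ∘ ι)) A →
        ∃ λ (Ms : List Obj) → Unique Ms × d * length A ≤ length Ms ×
          All (λ μ → InInt k′ k′ r μ × Hits D′ (φ ∘ ι) A μ) Ms)
lemma8 d k r _ _ r≥1 D φ Cs _ Cs⇔Used _ =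
  iterate (length Cs) (stage D (Contains-refl D) Cs (λ c → Equivalence.from (Cs⇔Used c)) ≤-refl) ≤-refl
  where open Iteration d r r≥1 D φ Cs
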